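{- Let $a,b,n$ be integers such that $n \ge 2$, $a \ge \max(1,|b|)$, and $b \ge 0$ whenever $n$ is even. Set $\delta := \gcd(a,b)$, $\alpha := \delta^{ -1} a$ and $\beta := \delta^{ -1} b$. (i) Assume that $\beta \ne -\alpha$ when $n$ is odd. Then $n^a \mid a^n + b^n$ and $n^\alpha \mid \alpha^n + \beta^n$ if and only if $(a,b,n) = (2,1,3)$ or $(a,b,n) = (2^c,2^c,2)$ for some $c \in \{0,1,2\}$. (ii) Assume that $\beta \ne \alpha$. Then $n^a \mid a^n - b^n$ and $n^\alpha \mid \alpha^n - \beta^n$ if and only if $(a,b,n) = (3,1,2)$ or $(a,b,n) = (2,-1,3)$. -}

module Defs where

open import Data.Nat as ℕ using (ℕ; zero; suc)
open import Data.Nat.GCD using (gcd)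
open import Data.Nat.DivMod using (_/_)
open import Data.Integer as ℤ using (ℤ; +_; ∣_∣; sign; _◃_)

δ : ℕ → ℤ → ℕ
δ a b = gcd a ∣ b ∣

-- exact division by a natural number; the value for divisor 0 is a junk
-- value never used (in the theorem a ≥ 1, so δ ≥ 1)
_÷ℕ_ : ℕ → ℕ → ℕ
m ÷ℕ zero = zero
m ÷ℕ suc d = m / suc d

α : ℕ → ℤ → ℕ
α a b = a ÷ℕ δ a b

β : ℕ → ℤ → ℤ
β a b = sign b ◃ (∣ b ∣ ÷ℕ δ a b)

module Submission where

-- Write a = αδ and b = βδ with α, β coprime. The reduced condition nᵅ ∣ αⁿ ∓ βⁿ pins down (α, β, n), and
-- then nᵅᵟ ∣ δⁿ(αⁿ ∓ βⁿ) pins down δ, because the exponential side outgrows the polynomial one.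
-- For odd n let p be the least prime factor of n. Then p ∤ αβ and gcd(n, p − 1) = 1, so Fermat's little
-- theorem upgrades αⁿ ≡ (∓β)ⁿ (mod p) to α ≡ ∓β (mod p), and lifting the exponent gives
-- p^((α−1)v_p(n)) ∣ α ± β; as |α ± β| ≤ 2α this leaves only α = 2, ∓β = −1, p = 3 and n = 3m with 3 ∤ m.
-- The same order argument at the least prime factor of m shows m = 1. For even n both α and β are odd:
-- for the sum αⁿ + βⁿ ≡ 2 (mod 4) forces α = 1, and for the difference lifting the exponent at 2 applied
-- to α², β² gives 2^α ≤ α² − β², so (α, β) = (3, 1), after which the order argument again gives n = 2.

module Congruence where

  open import Data.Integer using (ℤ; -_; _+_; _-_; _*_; _^_; 0ℤ)
  open import Data.Nat using (zero; suc)
  open import Data.Integer.Divisibility.Signed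
    using (_∣_; divides; ∣m∣n⇒∣m+n; ∣m⇒∣-m; ∣m⇒∣m*n; ∣n⇒∣m*n; ∣m∣n⇒∣m-n; ∣-trans)
  open import Data.Integer.Tactic.RingSolver using (solve-∀)
  open import Relation.Binary.Bundles using (Setoid)
  open import Relation.Binary.Structures using (IsEquivalence)
  open import Relation.Binary.PropositionalEquality using (_≡_; refl; sym; subst)

  infix 4 _≡_mod_

  -- A record rather than a synonym for m ∣ x - y, so that x, y and m can be inferred from it.
  record _≡_mod_ (x y m : ℤ) : Set where
    constructor modulo
    field ∣difference : m ∣ x - y
  open _≡_mod_ public

  module _ {m : ℤ} where

    mod-refl : ∀ {x} → x ≡ x mod m
    mod-refl {x} = modulo (divides 0ℤ (difference-self x))
      where
      difference-self : ∀ x → x - x ≡ 0ℤ * m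
      difference-self = solve-∀

    mod-sym : ∀ {x y} → x ≡ y mod m → y ≡ x mod m
    mod-sym {x} {y} (modulo d) = modulo (subst (m ∣_) (swap x y) (∣m⇒∣-m d))
      where
      swap : ∀ x y → - (x - y) ≡ y - x
      swap = solve-∀

    mod-trans : ∀ {x y z} → x ≡ y mod m → y ≡ z mod m → x ≡ z mod m
    mod-trans {x} {y} {z} (modulo d) (modulo e) = modulo (subst (m ∣_) (telescope x y z) (∣m∣n⇒∣m+n d e))
      where
      telescope : ∀ x y z → (x - y) + (y - z) ≡ x - z
      telescope = solve-∀

    ≡⇒≡-mod : ∀ {x y} → x ≡ y → x ≡ y mod m
    ≡⇒≡-mod refl = mod-refl

    +-cong-mod : ∀ {x y u v} → x ≡ y mod m → u ≡ v mod m → x + u ≡ y + v mod m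
    +-cong-mod {x} {y} {u} {v} (modulo d) (modulo e) = modulo (subst (m ∣_) (regroup x y u v) (∣m∣n⇒∣m+n d e))
      where
      regroup : ∀ x y u v → (x - y) + (u - v) ≡ (x + u) - (y + v)
      regroup = solve-∀

    *-cong-mod : ∀ {x y u v} → x ≡ y mod m → u ≡ v mod m → x * u ≡ y * v mod m
    *-cong-mod {x} {y} {u} {v} (modulo d) (modulo e) =
      modulo (subst (m ∣_) (regroup x y u v) (∣m∣n⇒∣m+n (∣m⇒∣m*n u d) (∣n⇒∣m*n y e)))
      where
      regroup : ∀ x y u v → (x - y) * u + y * (u - v) ≡ x * u - y * v
      regroup = solve-∀

    +-congˡ-mod : ∀ z {x y} → x ≡ y mod m → z + x ≡ z + y mod m
    +-congˡ-mod z = +-cong-mod (mod-refl {z})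

    *-congˡ-mod : ∀ z {x y} → x ≡ y mod m → z * x ≡ z * y mod m
    *-congˡ-mod z = *-cong-mod (mod-refl {z})

    ^-cong-mod : ∀ {x y} k → x ≡ y mod m → x ^ k ≡ y ^ k mod m
    ^-cong-mod zero    _  = mod-refl
    ^-cong-mod (suc k) eq = *-cong-mod eq (^-cong-mod k eq)

    ∣⇒≡0-mod : ∀ {x} → m ∣ x → x ≡ 0ℤ mod m
    ∣⇒≡0-mod {x} d = modulo (subst (m ∣_) (sym (minus-zero x)) d)
      where
      minus-zero : ∀ x → x - 0ℤ ≡ x
      minus-zero = solve-∀

    ≡0-mod⇒∣ : ∀ {x} → x ≡ 0ℤ mod m → m ∣ x
    ≡0-mod⇒∣ {x} (modulo d) = subst (m ∣_) (minus-zero x) d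
      where
      minus-zero : ∀ x → x - 0ℤ ≡ x
      minus-zero = solve-∀

    ∣-respects-mod : ∀ {x y} → x ≡ y mod m → m ∣ x → m ∣ y
    ∣-respects-mod {x} {y} (modulo d) h = subst (m ∣_) (cancel x y) (∣m∣n⇒∣m-n h d)
      where
      cancel : ∀ x y → x - (x - y) ≡ y
      cancel = solve-∀

    mod-isEquivalence : IsEquivalence (λ x y → x ≡ y mod m)
    mod-isEquivalence = record { refl = mod-refl ; sym = mod-sym ; trans = mod-trans }

  mod-weaken : ∀ {d m x y} → d ∣ m → x ≡ y mod m → x ≡ y mod d
  mod-weaken d∣m (modulo e) = modulo (∣-trans d∣m e)

  mod-setoid : ℤ → Setoid _ _
  mod-setoid m = record { isEquivalence = mod-isEquivalence {m} }

  module ≡-mod-Reasoning (m : ℤ) where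
    open import Relation.Binary.Reasoning.Setoid (mod-setoid m) public

module Arithmetic where

  open import Data.Nat as ℕ using (ℕ; zero; suc; NonZero; nonTrivial⇒≢1)
  import Data.Nat.Properties as ℕ
  import Data.Nat.Divisibility as ℕ
  open import Data.Nat.Primality using (Prime; prime; prime?; prime[2]; euclidsLemma; prime⇒nonTrivial; prime⇒nonZero; prime⇒irreducible)
  open import Data.Integer as ℤ using (ℤ; +_; -_; _+_; _-_; _*_; _^_; 1ℤ)
  open import Data.Integer.Properties using (*-comm; *-identityʳ; pos-*; abs-*; neg-distribˡ-*; ^-*-assoc)
  open import Data.Integer.Divisibility.Signed
    using (_∣_; divides; ∣-refl; ∣-trans; ∣⇒∣ᵤ; ∣ᵤ⇒∣; ∣m⇒∣m*n; *-monoʳ-∣; *-monoˡ-∣; *-cancelˡ-∣)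
  open import Data.Integer.Tactic.RingSolver using (solve-∀)
  open import Data.Product using (∃; _,_)
  open import Data.Sum using (_⊎_; inj₁; inj₂; [_,_]′)
  open import Function using (_∘_)
  open import Relation.Binary.PropositionalEquality
  open import Relation.Nullary using (¬_; contradiction)
  open import Relation.Nullary.Decidable using (from-yes)

  pos-^ : ∀ m k → + (m ℕ.^ k) ≡ (+ m) ^ k
  pos-^ m zero    = refl
  pos-^ m (suc k) = trans (pos-* m (m ℕ.^ k)) (cong (+ m *_) (pos-^ m k))

  ^-*-comm : ∀ x a b → x ^ (a ℕ.* b) ≡ (x ^ b) ^ a
  ^-*-comm x a b = trans (cong (x ^_) (ℕ.*-comm a b)) (sym (^-*-assoc x b a))

  1∣_ : ∀ a → 1ℤ ∣ a
  1∣ a = divides a (sym (*-identityʳ a))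

  ∣⇒∣^ : ∀ {d x} n → .{{NonZero n}} → d ∣ x → d ∣ x ^ n
  ∣⇒∣^ {x = x} (suc n) d∣x = ∣m⇒∣m*n (x ^ n) d∣x

  ^-mono-∣ : ∀ {a b} k → a ∣ b → a ^ k ∣ b ^ k
  ^-mono-∣ zero    _   = ∣-refl
  ^-mono-∣ {a} {b} (suc k) a∣b = ∣-trans (*-monoʳ-∣ a (^-mono-∣ k a∣b)) (*-monoˡ-∣ (b ^ k) a∣b)

  euclidsLemmaℤ : ∀ x y {p} → Prime p → + p ∣ x * y → + p ∣ x ⊎ + p ∣ y
  euclidsLemmaℤ x y p-prime p∣xy with euclidsLemma ℤ.∣ x ∣ ℤ.∣ y ∣ p-prime (subst (_ ℕ.∣_) (abs-* x y) (∣⇒∣ᵤ p∣xy))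
  ... | inj₁ p∣x = inj₁ (∣ᵤ⇒∣ p∣x)
  ... | inj₂ p∣y = inj₂ (∣ᵤ⇒∣ p∣y)

  prime∣^⇒∣ : ∀ {p x} → Prime p → ∀ k → + p ∣ x ^ k → + p ∣ x
  prime∣^⇒∣ {zero} (prime {{()}} _)
  prime∣^⇒∣ {suc (suc _)} _ zero p∣1 with ℕ.∣⇒≤ (∣⇒∣ᵤ p∣1)
  ... | ℕ.s≤s ()
  prime∣^⇒∣ {x = x} p-prime (suc k) p∣xxᵏ =
    [ (λ p∣x → p∣x) , prime∣^⇒∣ p-prime k ]′ (euclidsLemmaℤ x (x ^ k) p-prime p∣xxᵏ)

  prime^∣*⇒∣ : ∀ {p s} → Prime p → ¬ (+ p ∣ s) → ∀ t {a} → (+ p) ^ t ∣ a * s → (+ p) ^ t ∣ a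
  prime^∣*⇒∣ p-prime p∤s zero {a} _ = 1∣ a
  prime^∣*⇒∣ {p} {s} p-prime p∤s (suc t) {a} pᵗ⁺¹∣as =
    [ lift , (λ p∣s → contradiction p∣s p∤s) ]′ (euclidsLemmaℤ a s p-prime (∣-trans p∣pᵗ⁺¹ pᵗ⁺¹∣as))
    where
    instance
      p≢0 : ℕ.NonZero p
      p≢0 = prime⇒nonZero p-prime
    regroup : ∀ b p s → b * p * s ≡ p * (b * s)
    regroup = solve-∀
    p∣pᵗ⁺¹ : + p ∣ (+ p) ^ suc t
    p∣pᵗ⁺¹ = divides ((+ p) ^ t) (*-comm (+ p) _)
    lift : + p ∣ a → (+ p) ^ suc t ∣ a
    lift (divides b a≡bp) = subst ((+ p) ^ suc t ∣_) (trans (*-comm (+ p) b) (sym a≡bp))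
      (*-monoʳ-∣ (+ p) (prime^∣*⇒∣ p-prime p∤s t
        (*-cancelˡ-∣ (+ p) (subst ((+ p) ^ suc t ∣_) (trans (cong (_* s) a≡bp) (regroup b (+ p) s)) pᵗ⁺¹∣as))))

  prime∣prime⇒≡ : ∀ {p q} → Prime p → Prime q → q ℕ.∣ p → q ≡ p
  prime∣prime⇒≡ p-prime q-prime q∣p =
    [ (λ q≡1 → contradiction q≡1 (nonTrivial⇒≢1 {{prime⇒nonTrivial q-prime}})) , (λ q≡p → q≡p) ]′ (prime⇒irreducible p-prime q∣p)

  prime∤1 : ∀ {p} → Prime p → ¬ (+ p ∣ 1ℤ)
  prime∤1 p-prime p∣1 = nonTrivial⇒≢1 {{prime⇒nonTrivial p-prime}} (ℕ.∣1⇒≡1 (∣⇒∣ᵤ p∣1))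

  prime∣63 : ∀ {q} → Prime q → q ℕ.∣ 63 → q ≡ 3 ⊎ q ≡ 7
  prime∣63 {q} q-prime q∣63 = [ inj₂ ∘ prime∣prime⇒≡ (from-yes (prime? 7)) q-prime , inj₁ ∘ q∣9⇒q≡3 ]′ (euclidsLemma 7 9 q-prime q∣63)
    where
    q∣9⇒q≡3 : q ℕ.∣ 9 → q ≡ 3
    q∣9⇒q≡3 q∣9 = prime∣prime⇒≡ (from-yes (prime? 3)) q-prime (∣⇒∣ᵤ (prime∣^⇒∣ {x = + 3} q-prime 2 (∣ᵤ⇒∣ q∣9)))

  prime∣8⇒≡2 : ∀ {q} → Prime q → q ℕ.∣ 8 → q ≡ 2
  prime∣8⇒≡2 q-prime q∣8 = prime∣prime⇒≡ prime[2] q-prime (∣⇒∣ᵤ (prime∣^⇒∣ {x = + 2} q-prime 3 (∣ᵤ⇒∣ q∣8)))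

  odd⇒≡1+j*2 : ∀ n → ¬ (2 ℕ.∣ n) → ∃ λ j → n ≡ suc (j ℕ.* 2)
  odd⇒≡1+j*2 zero          2∤n = contradiction (ℕ.divides 0 refl) 2∤n
  odd⇒≡1+j*2 (suc zero)    _   = 0 , refl
  odd⇒≡1+j*2 (suc (suc n)) 2∤n with odd⇒≡1+j*2 n (λ 2∣n → 2∤n (ℕ.∣m∣n⇒∣m+n (ℕ.∣-refl {2}) 2∣n))
  ... | j , n≡1+2j = suc j , cong (λ m → suc (suc m)) n≡1+2j

  [-x]^n≡-x^n : ∀ x {n} → ¬ (2 ℕ.∣ n) → (- x) ^ n ≡ - (x ^ n)
  [-x]^n≡-x^n x {n} 2∤n with odd⇒≡1+j*2 n 2∤n
  ... | j , refl = begin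
    (- x) * (- x) ^ (j ℕ.* 2)   ≡⟨ cong ((- x) *_) (^-*-comm (- x) j 2) ⟩
    (- x) * ((- x) ^ 2) ^ j     ≡⟨ cong (λ s → (- x) * s ^ j) (square x) ⟩
    (- x) * (x ^ 2) ^ j         ≡⟨ cong ((- x) *_) (sym (^-*-comm x j 2)) ⟩
    (- x) * x ^ (j ℕ.* 2)       ≡⟨ sym (neg-distribˡ-* x _) ⟩
    - (x * x ^ (j ℕ.* 2))       ∎
    where
    open ≡-Reasoning
    square : ∀ x → (- x) * ((- x) * 1ℤ) ≡ x * (x * 1ℤ)
    square = solve-∀

module Binomial where

  open import Data.Nat
  open import Data.Nat.Properties
  open import Data.Nat.Combinatorics using (_C_; nCn≡1; nC1≡n; nCk≡nC[n∸k]; k>n⇒nCk≡0; nCk+nC[k+1]≡[n+1]C[k+1])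
  open import Data.Nat.Divisibility using (_∣_; divides; _∣0; ∣m∣n⇒∣m+n; ∣m⇒∣m*n; ∣⇒≤)
  open import Data.Nat.Primality using (Prime; prime; euclidsLemma)
  open import Data.Nat.Tactic.RingSolver using (solve-∀)
  open import Data.Product using (∃; _,_)
  open import Data.Sum using (inj₁; inj₂)
  open import Relation.Binary.PropositionalEquality
  open import Relation.Nullary using (contradiction)
  open ≡-Reasoning

  nC0≡1 : ∀ n → n C 0 ≡ 1
  nC0≡1 n = trans (nCk≡nC[n∸k] {0} {n} z≤n) (nCn≡1 n)

  [1+k]*[1+n]C[1+k]≡[1+n]*nCk : ∀ n k → suc k * (suc n C suc k) ≡ suc n * (n C k)
  [1+k]*[1+n]C[1+k]≡[1+n]*nCk zero zero = cong (1 *_) (trans (nCn≡1 1) (sym (nC0≡1 0)))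
  [1+k]*[1+n]C[1+k]≡[1+n]*nCk zero (suc k)
    rewrite k>n⇒nCk≡0 {1} {suc (suc k)} (s<s z<s) | k>n⇒nCk≡0 {0} {suc k} z<s = *-zeroʳ (suc (suc k))
  [1+k]*[1+n]C[1+k]≡[1+n]*nCk (suc n) zero rewrite nC1≡n (suc (suc n)) | nC0≡1 (suc n) = *-comm 1 (suc (suc n))
  [1+k]*[1+n]C[1+k]≡[1+n]*nCk (suc n) (suc k) = begin
    suc (suc k) * (2+n C suc (suc k))                                ≡⟨ cong (suc (suc k) *_) (sym (nCk+nC[k+1]≡[n+1]C[k+1] (suc n) (suc k))) ⟩
    suc (suc k) * (1+n C suc k + 1+n C suc (suc k))                  ≡⟨ regroup (suc k) (1+n C suc k) (1+n C suc (suc k)) ⟩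
    suc k * (1+n C suc k) + 1+n C suc k + suc (suc k) * (1+n C suc (suc k))
      ≡⟨ cong₂ (λ u v → u + 1+n C suc k + v) ([1+k]*[1+n]C[1+k]≡[1+n]*nCk n k) ([1+k]*[1+n]C[1+k]≡[1+n]*nCk n (suc k)) ⟩
    suc n * (n C k) + 1+n C suc k + suc n * (n C suc k)               ≡⟨ regroup′ (suc n) (n C k) (n C suc k) (1+n C suc k) ⟩
    suc n * (n C k + n C suc k) + 1+n C suc k                         ≡⟨ cong (λ u → suc n * u + 1+n C suc k) (nCk+nC[k+1]≡[n+1]C[k+1] n k) ⟩
    suc n * (1+n C suc k) + 1+n C suc k                               ≡⟨ +-comm (suc n * (1+n C suc k)) _ ⟩
    suc (suc n) * (1+n C suc k)                                       ∎
    where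
    1+n 2+n : ℕ
    1+n = suc n
    2+n = suc (suc n)
    regroup : ∀ k u v → suc k * (u + v) ≡ k * u + u + suc k * v
    regroup = solve-∀
    regroup′ : ∀ n u v w → n * u + w + n * v ≡ n * (u + v) + w
    regroup′ = solve-∀

  ∑< : ℕ → (ℕ → ℕ) → ℕ
  ∑< zero    f = 0
  ∑< (suc k) f = ∑< k f + f k

  ∑<-cong : ∀ k {f g} → (∀ i → f i ≡ g i) → ∑< k f ≡ ∑< k g
  ∑<-cong zero    eq = refl
  ∑<-cong (suc k) eq = cong₂ _+_ (∑<-cong k eq) (eq k)

  ∑<-suc : ∀ k f → ∑< (suc k) f ≡ f 0 + ∑< k (λ i → f (suc i))
  ∑<-suc zero    f = +-comm 0 (f 0)
  ∑<-suc (suc k) f = trans (cong (_+ f (suc k)) (∑<-suc k f)) (+-assoc (f 0) _ _)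

  ∑<-+ : ∀ k f g → ∑< k (λ i → f i + g i) ≡ ∑< k f + ∑< k g
  ∑<-+ zero    f g = refl
  ∑<-+ (suc k) f g = trans (cong (_+ (f k + g k)) (∑<-+ k f g)) (+-+-comm (∑< k f) (∑< k g) (f k) (g k))
    where
    +-+-comm : ∀ a b c d → a + b + (c + d) ≡ a + c + (b + d)
    +-+-comm = solve-∀

  *-distribˡ-∑< : ∀ x k f → x * ∑< k f ≡ ∑< k (λ i → x * f i)
  *-distribˡ-∑< x zero    f = *-zeroʳ x
  *-distribˡ-∑< x (suc k) f = trans (*-distribˡ-+ x (∑< k f) (f k)) (cong (_+ x * f k) (*-distribˡ-∑< x k f))

  ∣-∑< : ∀ {d} k f → (∀ i → i < k → d ∣ f i) → d ∣ ∑< k f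
  ∣-∑< zero    f h = _ ∣0
  ∣-∑< (suc k) f h = ∣m∣n⇒∣m+n (∣-∑< k f (λ i i<k → h i (m<n⇒m<1+n i<k))) (h k ≤-refl)

  binomial-theorem : ∀ x n → suc x ^ n ≡ ∑< (suc n) (λ i → (n C i) * x ^ i)
  binomial-theorem x zero    = refl
  binomial-theorem x (suc n) = sym (begin
    ∑< (suc (suc n)) (λ i → (suc n C i) * x ^ i)                      ≡⟨ ∑<-suc (suc n) _ ⟩
    (suc n C 0) * 1 + ∑< (suc n) (λ i → (suc n C suc i) * x ^ suc i)     ≡⟨ cong₂ _+_ (cong (_* 1) (nC0≡1 (suc n))) (∑<-cong (suc n) pascal) ⟩
    1 + ∑< (suc n) (λ i → (n C suc i) * x ^ suc i + x * ((n C i) * x ^ i)) ≡⟨ cong (1 +_) (∑<-+ (suc n) _ _) ⟩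
    1 + (T + ∑< (suc n) (λ i → x * ((n C i) * x ^ i)))                  ≡⟨ sym (+-assoc 1 T _) ⟩
    1 + T + ∑< (suc n) (λ i → x * ((n C i) * x ^ i))                    ≡⟨ cong₂ _+_ 1+T≡S (sym (*-distribˡ-∑< x (suc n) _)) ⟩
    suc x * S                                                         ≡⟨ cong (suc x *_) (sym (binomial-theorem x n)) ⟩
    suc x ^ suc n                                                     ∎)
    where
    S T : ℕ
    S = ∑< (suc n) (λ i → (n C i) * x ^ i)
    T = ∑< (suc n) (λ i → (n C suc i) * x ^ suc i)
    pascal : ∀ i → (suc n C suc i) * x ^ suc i ≡ (n C suc i) * x ^ suc i + x * ((n C i) * x ^ i)
    pascal i = trans (cong (_* x ^ suc i) (sym (nCk+nC[k+1]≡[n+1]C[k+1] n i))) (distribute (n C i) (n C suc i) x (x ^ i))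
      where
      distribute : ∀ a b x y → (a + b) * (x * y) ≡ b * (x * y) + x * (a * y)
      distribute = solve-∀
    1+T≡S : 1 + T ≡ S
    1+T≡S = begin
      1 + T                                       ≡⟨ cong (λ c → c * 1 + T) (sym (nC0≡1 n)) ⟩
      (n C 0) * 1 + T                             ≡⟨ sym (∑<-suc (suc n) _) ⟩
      ∑< (suc (suc n)) (λ i → (n C i) * x ^ i)     ≡⟨ cong (λ c → S + c * x ^ suc n) (k>n⇒nCk≡0 {n} ≤-refl) ⟩
      S + 0                                       ≡⟨ +-identityʳ S ⟩
      S                                           ∎

  prime∣pCk : ∀ {p k} → Prime p → 0 < k → k < p → p ∣ p C k
  prime∣pCk {zero} (prime {{()}} _)
  prime∣pCk {suc q} {suc i} p-prime _ k<p
    with euclidsLemma (suc i) (suc q C suc i) p-prime (divides (q C i) (trans ([1+k]*[1+n]C[1+k]≡[1+n]*nCk q i) (*-comm (suc q) _)))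
  ... | inj₁ p∣k = contradiction (∣⇒≤ p∣k) (<⇒≱ k<p)
  ... | inj₂ p∣C = p∣C

  freshman : ∀ {p} → Prime p → ∀ x → ∃ λ M → suc x ^ p ≡ 1 + M * p + x ^ p
  freshman {zero} (prime {{()}} _)
  freshman {1} (prime {{()}} _)
  freshman {p@(suc (suc r))} p-prime x = M , (begin
    suc x ^ p                                   ≡⟨ binomial-theorem x p ⟩
    ∑< p f + f p                                ≡⟨ cong (_+ f p) (∑<-suc (suc r) f) ⟩
    f 0 + ∑< (suc r) (λ i → f (suc i)) + f p    ≡⟨ cong₂ (λ u v → u + v + f p) (cong (_* 1) (nC0≡1 p)) middle ⟩
    1 + M * p + (p C p) * x ^ p                 ≡⟨ cong (λ c → 1 + M * p + c * x ^ p) (nCn≡1 p) ⟩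
    1 + M * p + 1 * x ^ p                       ≡⟨ cong (1 + M * p +_) (*-identityˡ (x ^ p)) ⟩
    1 + M * p + x ^ p                           ∎)
    where
    f : ℕ → ℕ
    f i = (p C i) * x ^ i
    open _∣_ (∣-∑< (suc r) (λ i → f (suc i)) (λ i i<r → ∣m⇒∣m*n (x ^ suc i) (prime∣pCk p-prime z<s (s≤s i<r))))
      renaming (quotient to M; equality to middle)

module Factors where

  open import Data.Nat
  open import Data.Nat.Properties
  open import Data.Nat.Divisibility using (_∣_; _∤_; _∣?_; divides; ∣⇒≤; ∣-refl; 0∣⇒≡0; hasNonTrivialDivisor)
  open import Data.Nat.Primality
  open import Data.Nat.Coprimality using (Coprime)
  open import Data.Nat.Induction using (<-rec)
  open import Data.Nat.Tactic.RingSolver using (solve-∀)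
  open import Data.Product using (_,_)
  open import Relation.Binary.PropositionalEquality
  open import Relation.Nullary using (yes; no; contradiction)

  record LeastPrimeFactor (n : ℕ) : Set where
    field
      p        : ℕ
      p-prime  : Prime p
      p∣n      : p ∣ n
      p-rough  : p Rough n

  private
    search : ∀ n fuel m → .{{NonTrivial m}} → m + fuel ≡ n → m Rough n → LeastPrimeFactor n
    search n fuel m eq rough with m ∣? n
    ... | yes m∣n = record { p = m ; p-prime = rough∧∣⇒prime rough m∣n ; p∣n = m∣n ; p-rough = rough }
    search n zero m eq rough | no m∤n = contradiction (subst (m ∣_) (trans (sym (+-identityʳ m)) eq) ∣-refl) m∤n
    search n (suc fuel) m eq rough | no m∤n =
      search n fuel (suc m) {{n>1⇒nonTrivial (m<n⇒m<1+n (nonTrivial⇒n>1 m))}} (trans (sym (+-suc m fuel)) eq) (∤⇒rough-suc m∤n rough)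

  leastPrimeFactor : ∀ n → .{{NonTrivial n}} → LeastPrimeFactor n
  leastPrimeFactor n = search n (n ∸ 2) 2 (m+[n∸m]≡n (nonTrivial⇒n>1 n)) 2-rough

  rough⇒coprime-pred : ∀ {n p} → Prime p → p Rough n → Coprime n (p ∸ 1)
  rough⇒coprime-pred {p = zero} (prime {{()}} _)
  rough⇒coprime-pred {p = suc q} p-prime rough {zero} (_ , 0∣q) =
    contradiction (cong suc (0∣⇒≡0 0∣q)) (nonTrivial⇒≢1 {{prime⇒nonTrivial p-prime}})
  rough⇒coprime-pred {p = suc q} p-prime rough {1} _ = refl
  rough⇒coprime-pred {p = suc q} p-prime rough {suc (suc i)} (i∣n , i∣q) =
    contradiction (hasNonTrivialDivisor (s≤s (∣⇒≤ {{q≢0}} i∣q)) i∣n) rough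
    where
    q≢0 : NonZero q
    q≢0 = >-nonZero (≤-pred (nonTrivial⇒n>1 (suc q) {{prime⇒nonTrivial p-prime}}))

  record PowerSplit (p n : ℕ) : Set where
    constructor powerSplit
    field
      k m   : ℕ
      n≡pᵏm : n ≡ p ^ k * m
      p∤m   : p ∤ m

  p-adic-split : ∀ {p} → 1 < p → ∀ n → 0 < n → PowerSplit p n
  p-adic-split {p} 1<p = <-rec _ split
    where
    rotate : ∀ p x m → x * m * p ≡ p * x * m
    rotate = solve-∀
    split : ∀ n → (∀ {r} → r < n → 0 < r → PowerSplit p r) → 0 < n → PowerSplit p n
    split n rec 0<n with p ∣? n
    ... | no p∤n = powerSplit 0 n (sym (+-identityʳ n)) p∤n
    ... | yes (divides q refl) with rec (m<m*n q p {{q≢0}} 1<p) (>-nonZero⁻¹ q {{q≢0}})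
      where
      q≢0 : NonZero q
      q≢0 = m*n≢0⇒m≢0 q {{>-nonZero 0<n}}
    ...   | powerSplit k m q≡pᵏm p∤m = powerSplit (suc k) m (trans (cong (_* p) q≡pᵏm) (rotate p (p ^ k) m)) p∤m

module Fermat where

  open import Data.Nat as ℕ using (ℕ; zero; suc; NonZero; nonTrivial⇒≢1)
  import Data.Nat.Properties as ℕ
  open import Data.Nat.Primality using (Prime; prime; _Rough_; prime⇒nonZero; prime⇒nonTrivial)
  import Data.Nat.Coprimality as ℕ
  open import Data.Nat.GCD using (module Bézout)
  open import Data.Integer as ℤ using (ℤ; +_; -_; _+_; _-_; _*_; _^_; 1ℤ)
  open import Data.Integer.Properties using (pos-*; ^-*-assoc; ^-zeroˡ; *-identityʳ)
  open import Data.Integer.DivMod using (_%ℕ_; _/ℕ_; a≡a%ℕn+[a/ℕn]*n)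
  open import Data.Integer.Divisibility.Signed using (_∣_; divides; ∣⇒∣ᵤ)
  open import Data.Integer.Coprimality using (Coprime)
  import Data.Integer.Coprimality as Coprime
  open import Data.Integer.Tactic.RingSolver using (solve-∀)
  open import Data.Product using (_,_)
  open import Data.Sum using ([_,_]′)
  open import Relation.Binary.PropositionalEquality
  open import Relation.Nullary using (¬_; contradiction)
  open Congruence
  open Arithmetic
  open Binomial using (freshman)
  open Factors using (rough⇒coprime-pred)

  freshman-mod : ∀ {p} → Prime p → ∀ x → (+ suc x) ^ p ≡ 1ℤ + (+ x) ^ p mod + p
  freshman-mod {p} p-prime x with freshman p-prime x
  ... | M , binomial = modulo (divides (+ M) (begin
    (+ suc x) ^ p - (1ℤ + (+ x) ^ p)                     ≡⟨ cong₂ (λ u v → u - (1ℤ + v)) (sym (pos-^ (suc x) p)) (sym (pos-^ x p)) ⟩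
    + (suc x ℕ.^ p) - (1ℤ + + (x ℕ.^ p))                 ≡⟨ cong (λ w → + w - (1ℤ + + (x ℕ.^ p))) binomial ⟩
    1ℤ + + (M ℕ.* p) + + (x ℕ.^ p) - (1ℤ + + (x ℕ.^ p))  ≡⟨ cancel (+ (M ℕ.* p)) (+ (x ℕ.^ p)) ⟩
    + (M ℕ.* p)                                          ≡⟨ pos-* M p ⟩
    + M * + p                                            ∎))
    where
    open ≡-Reasoning
    cancel : ∀ w u → 1ℤ + w + u - (1ℤ + u) ≡ w
    cancel = solve-∀

  fermat-pos : ∀ {p} → Prime p → ∀ x → (+ x) ^ p ≡ + x mod + p
  fermat-pos {zero}  (prime {{()}} _)
  fermat-pos {suc _} _       zero    = mod-refl
  fermat-pos         p-prime (suc x) = mod-trans (freshman-mod p-prime x) (+-congˡ-mod 1ℤ (fermat-pos p-prime x))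

  ≡-mod-%ℕ : ∀ z d .{{_ : ℕ.NonZero d}} → z ≡ + (z %ℕ d) mod + d
  ≡-mod-%ℕ z d = modulo (divides (z /ℕ d) (begin
    z - + (z %ℕ d)                          ≡⟨ cong (_- + (z %ℕ d)) (a≡a%ℕn+[a/ℕn]*n z d) ⟩
    + (z %ℕ d) + (z /ℕ d) * + d - + (z %ℕ d) ≡⟨ cancel (+ (z %ℕ d)) ((z /ℕ d) * + d) ⟩
    (z /ℕ d) * + d                          ∎))
    where
    open ≡-Reasoning
    cancel : ∀ r w → r + w - r ≡ w
    cancel = solve-∀

  fermat : ∀ {p} → Prime p → ∀ z → z ^ p ≡ z mod + p
  fermat {p} p-prime z =
    mod-trans (^-cong-mod p z≡r) (mod-trans (fermat-pos p-prime (z %ℕ p)) (mod-sym z≡r))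
    where
    instance
      p≢0 : ℕ.NonZero p
      p≢0 = prime⇒nonZero p-prime
    z≡r : z ≡ + (z %ℕ p) mod + p
    z≡r = ≡-mod-%ℕ z p

  fermat-unit : ∀ {p} → Prime p → ∀ {z} → ¬ (+ p ∣ z) → z ^ (p ℕ.∸ 1) ≡ 1ℤ mod + p
  fermat-unit {zero} (prime {{()}} _)
  fermat-unit {suc q} p-prime {z} p∤z =
    [ (λ p∣z → contradiction p∣z p∤z) , modulo ]′ (euclidsLemmaℤ z (z ^ q - 1ℤ) p-prime p∣z[z^q-1])
    where
    factor : ∀ z w → z * w - z ≡ z * (w - 1ℤ)
    factor = solve-∀
    p∣z[z^q-1] : + suc q ∣ z * (z ^ q - 1ℤ)
    p∣z[z^q-1] = subst (+ suc q ∣_) (factor z (z ^ q)) (∣difference (fermat p-prime z))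

  ^-cong-mod-1 : ∀ {m x} k → x ≡ 1ℤ mod m → x ^ k ≡ 1ℤ mod m
  ^-cong-mod-1 k x≡1 = mod-trans (^-cong-mod k x≡1) (≡⇒≡-mod (^-zeroˡ k))

  z*[z^b]^t≡[z^a]^s : ∀ z a b s t → 1 ℕ.+ t ℕ.* b ≡ s ℕ.* a → z * (z ^ b) ^ t ≡ (z ^ a) ^ s
  z*[z^b]^t≡[z^a]^s z a b s t bézout = begin
    z * (z ^ b) ^ t        ≡⟨ cong (z *_) (^-*-assoc z b t) ⟩
    z ^ (1 ℕ.+ b ℕ.* t)    ≡⟨ cong (λ e → z ^ (1 ℕ.+ e)) (ℕ.*-comm b t) ⟩
    z ^ (1 ℕ.+ t ℕ.* b)    ≡⟨ cong (z ^_) bézout ⟩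
    z ^ (s ℕ.* a)          ≡⟨ cong (z ^_) (ℕ.*-comm s a) ⟩
    z ^ (a ℕ.* s)          ≡⟨ sym (^-*-assoc z a s) ⟩
    (z ^ a) ^ s            ∎
    where open ≡-Reasoning

  ^-cancel-mod : ∀ {m x y n d} → x ^ n ≡ y ^ n mod m → x ^ d ≡ 1ℤ mod m → y ^ d ≡ 1ℤ mod m →
                 ℕ.Coprime n d → x ≡ y mod m
  ^-cancel-mod {m} {x} {y} {n} {d} xⁿ≡yⁿ xᵈ≡1 yᵈ≡1 n⊥d with ℕ.coprime-Bézout n⊥d
  ... | Bézout.+- u v bézout = begin
    x                  ≡⟨ sym (*-identityʳ x) ⟩
    x * 1ℤ             ≈⟨ *-congˡ-mod x (mod-sym (^-cong-mod-1 v xᵈ≡1)) ⟩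
    x * (x ^ d) ^ v    ≡⟨ z*[z^b]^t≡[z^a]^s x n d u v bézout ⟩
    (x ^ n) ^ u        ≈⟨ ^-cong-mod u xⁿ≡yⁿ ⟩
    (y ^ n) ^ u        ≡⟨ sym (z*[z^b]^t≡[z^a]^s y n d u v bézout) ⟩
    y * (y ^ d) ^ v    ≈⟨ *-congˡ-mod y (^-cong-mod-1 v yᵈ≡1) ⟩
    y * 1ℤ             ≡⟨ *-identityʳ y ⟩
    y                  ∎
    where open ≡-mod-Reasoning m
  -- Here w = (yⁿ)ᵘ ≡ (xⁿ)ᵘ is an inverse of both x and y, since z (zⁿ)ᵘ = (zᵈ)ᵛ.
  ... | Bézout.-+ u v bézout = begin
    x                   ≡⟨ sym (*-identityʳ x) ⟩
    x * 1ℤ              ≈⟨ *-congˡ-mod x (mod-sym y*w≡1) ⟩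
    x * (y * w)         ≡⟨ swap x y w ⟩
    y * (x * w)         ≈⟨ *-congˡ-mod y x*w≡1 ⟩
    y * 1ℤ              ≡⟨ *-identityʳ y ⟩
    y                   ∎
    where
    open ≡-mod-Reasoning m
    w : ℤ
    w = (y ^ n) ^ u
    swap : ∀ x y w → x * (y * w) ≡ y * (x * w)
    swap = solve-∀
    y*w≡1 : y * w ≡ 1ℤ mod m
    y*w≡1 = mod-trans (≡⇒≡-mod (z*[z^b]^t≡[z^a]^s y d n v u bézout)) (^-cong-mod-1 v yᵈ≡1)
    x*w≡1 : x * w ≡ 1ℤ mod m
    x*w≡1 = mod-trans (*-congˡ-mod x (mod-sym (^-cong-mod u xⁿ≡yⁿ)))
              (mod-trans (≡⇒≡-mod (z*[z^b]^t≡[z^a]^s x d n v u bézout)) (^-cong-mod-1 v xᵈ≡1))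

  prime∤-coprime-powers : ∀ {q x y n} → Prime q → Coprime x y → .{{NonZero n}} → x ^ n ≡ y ^ n mod + q → ¬ (+ q ∣ x)
  prime∤-coprime-powers {q} {y = y} {n} q-prime x⊥y xⁿ≡yⁿ q∣x =
    nonTrivial⇒≢1 {{prime⇒nonTrivial q-prime}} (x⊥y (∣⇒∣ᵤ q∣x , ∣⇒∣ᵤ q∣y))
    where
    q∣y : + q ∣ y
    q∣y = prime∣^⇒∣ q-prime n (∣-respects-mod xⁿ≡yⁿ (∣⇒∣^ n q∣x))

  rough⇒^-cancel-mod : ∀ {q n x y} → Prime q → q Rough n → .{{NonZero n}} → Coprime x y →
                      x ^ n ≡ y ^ n mod + q → x ≡ y mod + q
  rough⇒^-cancel-mod {x = x} {y} q-prime rough x⊥y xⁿ≡yⁿ =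
    ^-cancel-mod xⁿ≡yⁿ (fermat-unit q-prime (prime∤-coprime-powers q-prime x⊥y xⁿ≡yⁿ))
      (fermat-unit q-prime (prime∤-coprime-powers q-prime (Coprime.sym {x} {y} x⊥y) (mod-sym xⁿ≡yⁿ)))
      (rough⇒coprime-pred q-prime rough)

  rough⇒^≡1⇒≡1 : ∀ {q m} → Prime q → q Rough m → .{{NonZero m}} → ∀ x → x ^ m ≡ 1ℤ mod + q → x ≡ 1ℤ mod + q
  rough⇒^≡1⇒≡1 {m = m} q-prime rough x xᵐ≡1 =
    rough⇒^-cancel-mod q-prime rough (ℕ.sym (ℕ.1-coprimeTo ℤ.∣ x ∣)) (mod-trans xᵐ≡1 (mod-sym (≡⇒≡-mod (^-zeroˡ m))))

module LiftingTheExponent where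

  open import Data.Nat as ℕ using (ℕ; zero; suc; NonZero)
  import Data.Nat.Properties as ℕ
  import Data.Nat.Divisibility as ℕ
  open import Data.Nat.Primality using (Prime; prime⇒nonZero; prime⇒irreducible)
  open import Data.Integer as ℤ using (ℤ; +_; -_; _+_; _-_; _*_; _^_; 0ℤ; 1ℤ)
  open import Data.Integer.Properties
    using (*-comm; *-assoc; +-identityʳ; pos-*; ^-*-assoc; ^-distribˡ-+-*; i^n≡0⇒i≡0; i-j≡0⇒i≡j; ∣i∣≡0⇒i≡0)
  open import Data.Integer.Divisibility.Signed
    using (_∣_; module _∣_; divides; ∣-refl; ∣⇒∣ᵤ; ∣ᵤ⇒∣; ∣m⇒∣-m; ∣m∣n⇒∣m+n; ∣m⇒∣m*n; ∣n⇒∣m*n;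
           *-monoʳ-∣; *-cancelˡ-∣)
  open import Data.Integer.Tactic.RingSolver using (solve-∀)
  open import Data.Product using (_,_)
  open import Data.Sum using ([_,_]′)
  open import Relation.Binary.PropositionalEquality
  open import Relation.Nullary using (¬_; yes; no; contradiction)
  open import Function using (_∘_)
  open Congruence
  open Arithmetic
  open Fermat

  geometricSum : ℤ → ℤ → ℕ → ℤ
  geometricSum x y zero    = 0ℤ
  geometricSum x y (suc m) = x ^ m + y * geometricSum x y m

  x^m-y^m≡[x-y]*geometricSum : ∀ x y m → x ^ m - y ^ m ≡ (x - y) * geometricSum x y m
  x^m-y^m≡[x-y]*geometricSum x y zero    = vanish x y
    where
    vanish : ∀ x y → 1ℤ - 1ℤ ≡ (x - y) * 0ℤ
    vanish = solve-∀
  x^m-y^m≡[x-y]*geometricSum x y (suc m) = begin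
    x * x ^ m - y * y ^ m                  ≡⟨ split x y (x ^ m) (y ^ m) ⟩
    (x - y) * x ^ m + y * (x ^ m - y ^ m)  ≡⟨ cong (λ d → (x - y) * x ^ m + y * d) (x^m-y^m≡[x-y]*geometricSum x y m) ⟩
    (x - y) * x ^ m + y * ((x - y) * G)    ≡⟨ factor x y (x ^ m) G ⟩
    (x - y) * (x ^ m + y * G)              ∎
    where
    open ≡-Reasoning
    G : ℤ
    G = geometricSum x y m
    split : ∀ x y u v → x * u - y * v ≡ (x - y) * u + y * (u - v)
    split = solve-∀
    factor : ∀ x y u g → (x - y) * u + y * ((x - y) * g) ≡ (x - y) * (u + y * g)
    factor = solve-∀

  x*geometricSum≡k*x^k : ∀ {m x y} k → x ≡ y mod m → x * geometricSum x y k ≡ + k * x ^ k mod m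
  x*geometricSum≡k*x^k {x = x} zero _ = ≡⇒≡-mod (vanish x)
    where
    vanish : ∀ x → x * 0ℤ ≡ 0ℤ * 1ℤ
    vanish = solve-∀
  x*geometricSum≡k*x^k {x = x} {y} (suc k) x≡y =
    mod-trans (≡⇒≡-mod (expand x y (x ^ k) (geometricSum x y k)))
      (mod-trans (+-congˡ-mod (x * x ^ k) (*-cong-mod (mod-sym x≡y) (x*geometricSum≡k*x^k k x≡y)))
        (≡⇒≡-mod (collect x (x ^ k) (+ k))))
    where
    expand : ∀ x y u g → x * (u + y * g) ≡ x * u + y * (x * g)
    expand = solve-∀
    collect : ∀ x u k → x * u + x * (k * u) ≡ (1ℤ + k) * (x * u)
    collect = solve-∀

  triangular : ℕ → ℕ
  triangular zero    = 0
  triangular (suc m) = triangular m ℕ.+ m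

  triangular[1+2j]≡[1+2j]*j : ∀ j → triangular (suc (j ℕ.* 2)) ≡ suc (j ℕ.* 2) ℕ.* j
  triangular[1+2j]≡[1+2j]*j zero    = refl
  triangular[1+2j]≡[1+2j]*j (suc j) = trans (cong (λ t → t ℕ.+ suc (j ℕ.* 2) ℕ.+ suc (suc (j ℕ.* 2))) (triangular[1+2j]≡[1+2j]*j j)) (grow j)
    where
    grow : ∀ j → suc (j ℕ.* 2) ℕ.* j ℕ.+ suc (j ℕ.* 2) ℕ.+ suc (suc (j ℕ.* 2)) ≡ suc (suc j ℕ.* 2) ℕ.* suc j
    grow = NatSolver.solve-∀
      where import Data.Nat.Tactic.RingSolver as NatSolver

  -- First-order expansion of Σ xᵐ⁻¹⁻ⁱ (x + d)ⁱ ≡ m xᵐ⁻¹ + T(m) xᵐ⁻² d, multiplied by x² to avoid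
  -- negative exponents.
  geometricSum-expansion : ∀ x d m →
    x * x * geometricSum x (x + d) m ≡ + m * (x * x ^ m) + + triangular m * x ^ m * d mod d * d
  geometricSum-expansion x d zero = ≡⇒≡-mod (vanish x d)
    where
    vanish : ∀ x d → x * x * 0ℤ ≡ 0ℤ * (x * 1ℤ) + 0ℤ * 1ℤ * d
    vanish = solve-∀
  geometricSum-expansion x d (suc m) =
    mod-trans (≡⇒≡-mod (expand x d (x ^ m) (geometricSum x (x + d) m)))
      (mod-trans (+-congˡ-mod (x * x * x ^ m) (*-congˡ-mod (x + d) (geometricSum-expansion x d m)))
        (modulo (divides (+ triangular m * x ^ m) (drop-d² x d (x ^ m) (+ m) (+ triangular m)))))
    where
    expand : ∀ x d u g → x * x * (u + (x + d) * g) ≡ x * x * u + (x + d) * (x * x * g)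
    expand = solve-∀
    drop-d² : ∀ x d u m t → x * x * u + (x + d) * (m * (x * u) + t * u * d)
                            - ((1ℤ + m) * (x * (x * u)) + (t + m) * (x * u) * d) ≡ t * u * (d * d)
    drop-d² = solve-∀

  -- For odd p the term T(p) = p(p − 1)/2 vanishes modulo p², leaving x² G ≡ p x^(p+1).
  p²∤geometricSum : ∀ {p x y} → Prime p → p ℕ.∣ triangular p → x ≡ y mod + p → ¬ (+ p ∣ x) →
                    ¬ (+ p * + p ∣ geometricSum x y p)
  p²∤geometricSum {p} {x} {y} p-prime (ℕ.divides t T≡tp) x≡y p∤x p²∣G =
    p∤x (prime∣^⇒∣ p-prime (suc p) (*-cancelˡ-∣ (+ p) (≡0-mod⇒∣ p*x^[1+p]≡0)))
    where
    instance
      p≢0 : ℕ.NonZero p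
      p≢0 = prime⇒nonZero p-prime
    d : ℤ
    d = y - x
    p∣d : + p ∣ d
    p∣d = subst (+ p ∣_) (negate x y) (∣m⇒∣-m (∣difference x≡y))
      where
      negate : ∀ x y → - (x - y) ≡ y - x
      negate = solve-∀
    open _∣_ p∣d renaming (quotient to e; equality to d≡ep)
    p²∣d² : + p * + p ∣ d * d
    p²∣d² = divides (e * e) (trans (cong₂ _*_ d≡ep d≡ep) (square e (+ p)))
      where
      square : ∀ e p → e * p * (e * p) ≡ e * e * (p * p)
      square = solve-∀
    y≡x+d : y ≡ x + d
    y≡x+d = recombine x y
      where
      recombine : ∀ x y → y ≡ x + (y - x)
      recombine = solve-∀
    triangular-term≡0 : + triangular p * x ^ p * d ≡ 0ℤ mod + p * + p
    triangular-term≡0 = ∣⇒≡0-mod (divides (+ t * x ^ p * e)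
      (trans (cong₂ (λ T d → + T * x ^ p * d) T≡tp d≡ep) (trans (cong (λ T → T * x ^ p * (e * + p)) (pos-* t p)) (regroup (+ t) (+ p) (x ^ p) e))))
      where
      regroup : ∀ t p u e → t * p * u * (e * p) ≡ t * u * e * (p * p)
      regroup = solve-∀
    p*x^[1+p]≡0 : + p * (x * x ^ p) ≡ 0ℤ mod + p * + p
    p*x^[1+p]≡0 = begin
      + p * (x * x ^ p)                                     ≡⟨ sym (+-identityʳ _) ⟩
      + p * (x * x ^ p) + 0ℤ                                ≈⟨ +-congˡ-mod (+ p * (x * x ^ p)) (mod-sym triangular-term≡0) ⟩
      + p * (x * x ^ p) + + triangular p * x ^ p * d        ≈⟨ mod-sym (mod-weaken p²∣d² (geometricSum-expansion x d p)) ⟩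
      x * x * geometricSum x (x + d) p                      ≡⟨ cong (λ z → x * x * geometricSum x z p) (sym y≡x+d) ⟩
      x * x * geometricSum x y p                            ≈⟨ ∣⇒≡0-mod (∣n⇒∣m*n (x * x) p²∣G) ⟩
      0ℤ                                                    ∎
      where open ≡-mod-Reasoning (+ p * + p)

  4∤geometricSum : ∀ {x y} → x ≡ y mod + 4 → ¬ (+ 2 ∣ x) → ¬ (+ 4 ∣ geometricSum x y 2)
  4∤geometricSum {x} {y} x≡y p∤x 4∣G = p∤x (*-cancelˡ-∣ (+ 2) (subst (+ 4 ∣_) (sum x y) (∣m∣n⇒∣m+n (∣difference x≡y) 4∣G)))
    where
    sum : ∀ x y → (x - y) + (x * 1ℤ + y * (1ℤ + y * 0ℤ)) ≡ + 2 * x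
    sum = solve-∀

  odd⇒∣triangular : ∀ {p} → ¬ (2 ℕ.∣ p) → p ℕ.∣ triangular p
  odd⇒∣triangular {p} 2∤p with odd⇒≡1+j*2 p 2∤p
  ... | j , refl = ℕ.divides j (trans (triangular[1+2j]≡[1+2j]*j j) (ℕ.*-comm (suc (j ℕ.* 2)) j))

  -- At p = 2 lifting the exponent needs x ≡ y modulo 4, not just modulo 2.
  record LiftingConditions (p : ℕ) (x y : ℤ) : Set where
    field
      p-prime : Prime p
      x≡y     : x ≡ y mod + p
      p∤x     : ¬ (+ p ∣ x)
      x≡y[4]  : p ≡ 2 → x ≡ y mod + 4

  ^-lifting : ∀ {p x y} k → LiftingConditions p x y → LiftingConditions p (x ^ k) (y ^ k)
  ^-lifting k L = record
    { p-prime = p-prime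
    ; x≡y     = ^-cong-mod k x≡y
    ; p∤x     = λ p∣xᵏ → p∤x (prime∣^⇒∣ p-prime k p∣xᵏ)
    ; x≡y[4]  = λ p≡2 → ^-cong-mod k (x≡y[4] p≡2)
    }
    where open LiftingConditions L

  module _ {p x y} (L : LiftingConditions p x y) where
    open LiftingConditions L

    p²∤geometricSum[p] : ¬ (+ p * + p ∣ geometricSum x y p)
    p²∤geometricSum[p] with p ℕ.≟ 2
    ... | yes refl = 4∤geometricSum (x≡y[4] refl) p∤x
    ... | no p≢2   = p²∤geometricSum p-prime (odd⇒∣triangular 2∤p) x≡y p∤x
      where
      2∤p : ¬ (2 ℕ.∣ p)
      2∤p 2∣p = [ (λ ()) , p≢2 ∘ sym ]′ (prime⇒irreducible p-prime 2∣p)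

    lte-coprime-exponent : ∀ {m} t → ¬ (p ℕ.∣ m) → (+ p) ^ t ∣ x ^ m - y ^ m → (+ p) ^ t ∣ x - y
    lte-coprime-exponent {m} t p∤m pᵗ∣xᵐ-yᵐ =
      prime^∣*⇒∣ p-prime p∤G t (subst (_ ∣_) (x^m-y^m≡[x-y]*geometricSum x y m) pᵗ∣xᵐ-yᵐ)
      where
      p∤G : ¬ (+ p ∣ geometricSum x y m)
      p∤G p∣G = [ p∤m ∘ ∣⇒∣ᵤ , p∤x ∘ prime∣^⇒∣ p-prime m ]′
        (euclidsLemmaℤ (+ m) (x ^ m) p-prime (∣-respects-mod (x*geometricSum≡k*x^k m x≡y) (∣n⇒∣m*n x p∣G)))

    lte-prime-exponent : ∀ t → (+ p) ^ suc t ∣ x ^ p - y ^ p → (+ p) ^ t ∣ x - y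
    lte-prime-exponent t pᵗ⁺¹∣xᵖ-yᵖ = prime^∣*⇒∣ p-prime p∤g t (*-cancelˡ-∣ (+ p) pᵗ⁺¹∣p[x-y]g)
      where
      instance
        p≢0 : ℕ.NonZero p
        p≢0 = prime⇒nonZero p-prime
      G : ℤ
      G = geometricSum x y p
      p∣G : + p ∣ G
      p∣G = [ (λ p∣x → contradiction p∣x p∤x) , (λ p∣G → p∣G) ]′ (euclidsLemmaℤ x G p-prime
        (∣-respects-mod (mod-sym (x*geometricSum≡k*x^k p x≡y)) (∣m⇒∣m*n (x ^ p) ∣-refl)))
      open _∣_ p∣G renaming (quotient to g; equality to G≡gp)
      p∤g : ¬ (+ p ∣ g)
      p∤g (divides h g≡hp) = p²∤geometricSum[p] (divides h (trans G≡gp (trans (cong (_* + p) g≡hp) (*-assoc h (+ p) (+ p)))))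
      pᵗ⁺¹∣p[x-y]g : + p * (+ p) ^ t ∣ + p * ((x - y) * g)
      pᵗ⁺¹∣p[x-y]g = subst (_ ∣_)
        (trans (x^m-y^m≡[x-y]*geometricSum x y p) (trans (cong ((x - y) *_) G≡gp) (regroup (x - y) g (+ p))))
        pᵗ⁺¹∣xᵖ-yᵖ
        where
        regroup : ∀ a g p → a * (g * p) ≡ p * (a * g)
        regroup = solve-∀

  lte-prime-power : ∀ {p x y} → LiftingConditions p x y → ∀ k t →
                    (+ p) ^ t ∣ x ^ (p ℕ.^ k) - y ^ (p ℕ.^ k) → (+ p) ^ t ∣ (x - y) * (+ p) ^ k
  lte-prime-power {x = x} {y} L zero t pᵗ∣x-y = subst (_ ∣_) (factor x y) pᵗ∣x-y
    where
    factor : ∀ x y → x * 1ℤ - y * 1ℤ ≡ (x - y) * 1ℤ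
    factor = solve-∀
  lte-prime-power {x = x} {y} L (suc k) zero _ = 1∣ ((x - y) * (+ _) ^ suc k)
  lte-prime-power {p} {x} {y} L (suc k) (suc t) pᵗ⁺¹∣ =
    subst (_ ∣_) (regroup (+ p) (x - y) ((+ p) ^ k))
      (*-monoʳ-∣ (+ p) (lte-prime-power L k t (lte-prime-exponent (^-lifting (p ℕ.^ k) L) t
        (subst (_ ∣_) (cong₂ _-_ (^-*-comm x p (p ℕ.^ k)) (^-*-comm y p (p ℕ.^ k))) pᵗ⁺¹∣))))
    where
    regroup : ∀ p a q → p * (a * q) ≡ a * (p * q)
    regroup = solve-∀

  lifting-the-exponent : ∀ {p x y m} → LiftingConditions p x y → ¬ (p ℕ.∣ m) → ∀ k t →
                         (+ p) ^ t ∣ x ^ (p ℕ.^ k ℕ.* m) - y ^ (p ℕ.^ k ℕ.* m) → (+ p) ^ t ∣ (x - y) * (+ p) ^ k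
  lifting-the-exponent {p} {x} {y} {m} L p∤m k t pᵗ∣ =
    lte-prime-power L k t (lte-coprime-exponent (^-lifting (p ℕ.^ k) L) t p∤m
      (subst (_ ∣_) (cong₂ _-_ (sym (^-*-assoc x (p ℕ.^ k) m)) (sym (^-*-assoc y (p ℕ.^ k) m))) pᵗ∣))

  prime-power∣base-power : ∀ {p n} k m α → n ≡ p ℕ.^ k ℕ.* m → (+ p) ^ (k ℕ.* α) ∣ (+ n) ^ α
  prime-power∣base-power {p} {n} k m α n≡pᵏm =
    subst (_∣ (+ n) ^ α) (^-*-assoc (+ p) k α) (^-mono-∣ α (∣ᵤ⇒∣ pᵏ∣n))
    where
    pᵏ∣n : ℤ.∣ (+ p) ^ k ∣ ℕ.∣ n
    pᵏ∣n = subst (ℕ._∣ n) (cong ℤ.∣_∣ (pos-^ p k)) (ℕ.divides m (trans n≡pᵏm (ℕ.*-comm (p ℕ.^ k) m)))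

  lte-bound : ∀ {p x y m} k t → LiftingConditions p x y → ¬ (p ℕ.∣ m) → x ≢ y →
              (+ p) ^ (k ℕ.+ t) ∣ x ^ (p ℕ.^ k ℕ.* m) - y ^ (p ℕ.^ k ℕ.* m) → p ℕ.^ t ℕ.≤ ℤ.∣ x - y ∣
  lte-bound {p} {x} {y} k t L p∤m x≢y pᵏ⁺ᵗ∣ =
    ℕ.∣⇒≤ {{x-y≢0}} (subst (ℕ._∣ ℤ.∣ x - y ∣) (cong ℤ.∣_∣ (sym (pos-^ p t))) (∣⇒∣ᵤ pᵗ∣x-y))
    where
    open LiftingConditions L
    instance
      pᵏ≢0 : ℤ.NonZero ((+ p) ^ k)
      pᵏ≢0 = ℤ.≢-nonZero (λ pᵏ≡0 → ℕ.≢-nonZero⁻¹ p {{prime⇒nonZero p-prime}} (cong ℤ.∣_∣ (i^n≡0⇒i≡0 (+ p) k pᵏ≡0)))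
    x-y≢0 : NonZero ℤ.∣ x - y ∣
    x-y≢0 = ℕ.≢-nonZero (λ ∣x-y∣≡0 → x≢y (i-j≡0⇒i≡j x y (∣i∣≡0⇒i≡0 ∣x-y∣≡0)))
    pᵗ∣x-y : (+ p) ^ t ∣ x - y
    pᵗ∣x-y = *-cancelˡ-∣ ((+ p) ^ k)
      (subst₂ _∣_ (^-distribˡ-+-* (+ p) k t) (*-comm (x - y) _) (lifting-the-exponent L p∤m k (k ℕ.+ t) pᵏ⁺ᵗ∣))

module Growth where

  open import Data.Nat
  open import Data.Nat.Properties
  open import Data.Nat.Tactic.RingSolver using (solve-∀)
  open import Data.Sum using (inj₁; inj₂)
  open import Relation.Binary.PropositionalEquality
  open import Relation.Nullary.Decidable using (from-yes)

  <^-by-ratio : ∀ (f : ℕ → ℕ) c b .{{_ : NonZero c}} → f b < c ^ b → (∀ x → b ≤ x → f (suc x) ≤ c * f x) →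
                ∀ x → b ≤ x → f x < c ^ x
  <^-by-ratio f c b base step zero b≤0 = subst (λ b → f b < c ^ b) (n≤0⇒n≡0 b≤0) base
  <^-by-ratio f c b base step (suc x) b≤1+x with m≤n⇒m<n∨m≡n b≤1+x
  ... | inj₂ refl  = base
  ... | inj₁ b<1+x = begin-strict
    f (suc x)    ≤⟨ step x (≤-pred b<1+x) ⟩
    c * f x      <⟨ *-monoʳ-< c (<^-by-ratio f c b base step x (≤-pred b<1+x)) ⟩
    c * c ^ x    ∎
    where open ≤-Reasoning

  private
    ≤-by-excess : ∀ {a b} c → a + c ≡ b → a ≤ b
    ≤-by-excess {a} c refl = m≤m+n a c

  2*[1+n]<3^n : ∀ n → 2 ≤ n → 2 * suc n < 3 ^ n
  2*[1+n]<3^n = <^-by-ratio (λ n → 2 * suc n) 3 2 (from-yes (6 <? 9)) step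
    where
    excess : ∀ y → 2 * suc (3 + y) + (4 * y + 10) ≡ 3 * (2 * suc (2 + y))
    excess = solve-∀
    step : ∀ x → 2 ≤ x → 2 * suc (suc x) ≤ 3 * (2 * suc x)
    step .(2 + y) (s≤s (s≤s {n = y} z≤n)) = ≤-by-excess _ (excess y)

  n*n<2^n : ∀ n → 5 ≤ n → n * n < 2 ^ n
  n*n<2^n = <^-by-ratio (λ n → n * n) 2 5 (from-yes (25 <? 32)) step
    where
    excess : ∀ y → (6 + y) * (6 + y) + (y * y + 8 * y + 14) ≡ 2 * ((5 + y) * (5 + y))
    excess = solve-∀
    step : ∀ x → 5 ≤ x → suc x * suc x ≤ 2 * (x * x)
    step .(5 + y) (s≤s (s≤s (s≤s (s≤s (s≤s {n = y} z≤n))))) = ≤-by-excess _ (excess y)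

  9*n³<9^n : ∀ n → 2 ≤ n → 9 * (n * n * n) < 9 ^ n
  9*n³<9^n = <^-by-ratio (λ n → 9 * (n * n * n)) 9 2 (from-yes (72 <? 81)) step
    where
    excess : ∀ y → 9 * ((3 + y) * (3 + y) * (3 + y)) + (72 * (y * y * y) + 405 * (y * y) + 729 * y + 405)
                   ≡ 9 * (9 * ((2 + y) * (2 + y) * (2 + y)))
    excess = solve-∀
    step : ∀ x → 2 ≤ x → 9 * (suc x * suc x * suc x) ≤ 9 * (9 * (x * x * x))
    step .(2 + y) (s≤s (s≤s {n = y} z≤n)) = ≤-by-excess _ (excess y)

  2*n²<2^n : ∀ n → 7 ≤ n → 2 * (n * n) < 2 ^ n
  2*n²<2^n = <^-by-ratio (λ n → 2 * (n * n)) 2 7 (from-yes (98 <? 128)) step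
    where
    excess : ∀ y → 2 * ((8 + y) * (8 + y)) + (2 * (y * y) + 24 * y + 68) ≡ 2 * (2 * ((7 + y) * (7 + y)))
    excess = solve-∀
    step : ∀ x → 7 ≤ x → 2 * (suc x * suc x) ≤ 2 * (2 * (x * x))
    step .(7 + y) (s≤s (s≤s (s≤s (s≤s (s≤s (s≤s (s≤s {n = y} z≤n))))))) = ≤-by-excess _ (excess y)

  8*n²<8^n : ∀ n → 2 ≤ n → 8 * (n * n) < 8 ^ n
  8*n²<8^n = <^-by-ratio (λ n → 8 * (n * n)) 8 2 (from-yes (32 <? 64)) step
    where
    excess : ∀ y → 8 * ((3 + y) * (3 + y)) + (56 * (y * y) + 208 * y + 184) ≡ 8 * (8 * ((2 + y) * (2 + y)))
    excess = solve-∀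
    step : ∀ x → 2 ≤ x → 8 * (suc x * suc x) ≤ 8 * (8 * (x * x))
    step .(2 + y) (s≤s (s≤s {n = y} z≤n)) = ≤-by-excess _ (excess y)

module Reduction where

  open import Defs
  open import Data.Nat as ℕ using (ℕ; suc; _≤_; NonZero; ≢-nonZero; >-nonZero⁻¹)
  import Data.Nat.Properties as ℕ
  open import Data.Nat.DivMod using (_/_; m/n*n≡m; /-monoˡ-≤)
  open import Data.Nat.GCD using (gcd[m,n]∣m; gcd[m,n]∣n; gcd[m,n]≢0)
  import Data.Nat.Coprimality as ℕ
  open import Data.Integer as ℤ using (ℤ; +_; -_; -[1+_]; sign; 0ℤ)
  open import Data.Integer.Properties using (+◃n≡+n; -◃n≡-n; abs-◃; pos-*; neg-distribˡ-*)
  open import Data.Integer.Coprimality using (Coprime)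
  import Data.Sign as Sign
  open import Data.Sum using (inj₁)
  open import Relation.Binary.PropositionalEquality

  ÷ℕ≡/ : ∀ m d .{{_ : NonZero d}} → m ÷ℕ d ≡ m / d
  ÷ℕ≡/ m (suc d) = refl

  module _ (a : ℕ) (b : ℤ) (1≤a : 1 ≤ a) where

    instance
      δ≢0 : NonZero (δ a b)
      δ≢0 = ≢-nonZero (gcd[m,n]≢0 a ℤ.∣ b ∣ (inj₁ (λ a≡0 → ℕ.<⇒≢ 1≤a (sym a≡0))))

    1≤δ : 1 ≤ δ a b
    1≤δ = >-nonZero⁻¹ (δ a b)

    ∣β∣≡∣b∣/δ : ℤ.∣ β a b ∣ ≡ ℤ.∣ b ∣ / δ a b
    ∣β∣≡∣b∣/δ = trans (abs-◃ (sign b) _) (÷ℕ≡/ ℤ.∣ b ∣ (δ a b))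

    a≡α*δ : a ≡ α a b ℕ.* δ a b
    a≡α*δ = sym (trans (cong (ℕ._* δ a b) (÷ℕ≡/ a (δ a b))) (m/n*n≡m (gcd[m,n]∣m a ℤ.∣ b ∣)))

    α⊥β : Coprime (+ α a b) (β a b)
    α⊥β = subst₂ ℕ.Coprime (sym (÷ℕ≡/ a (δ a b))) (sym ∣β∣≡∣b∣/δ) (ℕ.coprime-/gcd a ℤ.∣ b ∣)

    ∣β∣≤α : ℤ.∣ b ∣ ≤ a → ℤ.∣ β a b ∣ ≤ α a b
    ∣β∣≤α ∣b∣≤a = subst₂ _≤_ (sym ∣β∣≡∣b∣/δ) (sym (÷ℕ≡/ a (δ a b))) (/-monoˡ-≤ (δ a b) ∣b∣≤a)

    1≤α : 1 ≤ α a b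
    1≤α = ℕ.n≢0⇒n>0 (λ α≡0 → ℕ.<⇒≢ 1≤a (sym (trans a≡α*δ (cong (ℕ._* δ a b) α≡0))))

  b≡β*δ : ∀ a b → 1 ≤ a → b ≡ β a b ℤ.* + δ a b
  b≡β*δ a (+ k) 1≤a = begin
    + k                                    ≡⟨ cong +_ (sym (m/n*n≡m (gcd[m,n]∣n a k))) ⟩
    + (k / δ′ ℕ.* δ′)                      ≡⟨ pos-* (k / δ′) δ′ ⟩
    + (k / δ′) ℤ.* + δ′                    ≡⟨ cong (λ q → + q ℤ.* + δ′) (sym (÷ℕ≡/ k δ′)) ⟩
    + (k ÷ℕ δ′) ℤ.* + δ′                   ≡⟨ cong (ℤ._* + δ′) (sym (+◃n≡+n (k ÷ℕ δ′))) ⟩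
    β a (+ k) ℤ.* + δ′                     ∎
    where
    open ≡-Reasoning
    δ′ : ℕ
    δ′ = δ a (+ k)
    instance
      δ′≢0 : NonZero δ′
      δ′≢0 = δ≢0 a (+ k) 1≤a
  b≡β*δ a -[1+ k ] 1≤a = begin
    -[1+ k ]                               ≡⟨ cong (λ m → - (+ m)) (sym (m/n*n≡m (gcd[m,n]∣n a (suc k)))) ⟩
    - + (suc k / δ′ ℕ.* δ′)                ≡⟨ cong -_ (pos-* (suc k / δ′) δ′) ⟩
    - (+ (suc k / δ′) ℤ.* + δ′)            ≡⟨ neg-distribˡ-* (+ (suc k / δ′)) (+ δ′) ⟩
    - + (suc k / δ′) ℤ.* + δ′              ≡⟨ cong (λ q → - + q ℤ.* + δ′) (sym (÷ℕ≡/ (suc k) δ′)) ⟩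
    - + (suc k ÷ℕ δ′) ℤ.* + δ′             ≡⟨ cong (ℤ._* + δ′) (sym (-◃n≡-n (suc k ÷ℕ δ′))) ⟩
    β a -[1+ k ] ℤ.* + δ′                  ∎
    where
    open ≡-Reasoning
    δ′ : ℕ
    δ′ = δ a -[1+ k ]
    instance
      δ′≢0 : NonZero δ′
      δ′≢0 = δ≢0 a -[1+ k ] 1≤a

  0≤b⇒β≡+∣β∣ : ∀ a b → 0ℤ ℤ.≤ b → β a b ≡ + ℤ.∣ β a b ∣
  0≤b⇒β≡+∣β∣ a (+ k) _ = trans (+◃n≡+n (k ÷ℕ δ a (+ k))) (cong +_ (sym (abs-◃ Sign.+ (k ÷ℕ δ a (+ k)))))

module OddExponent where

  open import Data.Nat as ℕ using (ℕ; zero; suc; s≤s; NonZero)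
  import Data.Nat.Properties as ℕ
  import Data.Nat.Divisibility as ℕ
  open import Data.Nat.Primality using (Prime; _Rough_; prime?; prime[2]; prime⇒nonTrivial; prime⇒nonZero)
  open import Data.Integer as ℤ using (ℤ; +_; -_; -[1+_]; _+_; _-_; _*_; _^_; 1ℤ; -1ℤ)
  open import Data.Integer.Properties using (^-*-assoc; ^-zeroˡ; ∣i-j∣≤∣i∣+∣j∣)
  open import Data.Integer.Divisibility.Signed using (_∣_; divides; ∣-trans; ∣⇒∣ᵤ; ∣ᵤ⇒∣)
  open import Data.Integer.Coprimality using (Coprime)
  open import Data.Empty using (⊥; ⊥-elim)
  open import Data.Product using (_×_; _,_; proj₁; proj₂)
  open import Data.Sum using ([_,_]′)
  open import Function using (_∘_)
  open import Relation.Binary.PropositionalEquality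
  open import Relation.Nullary using (¬_; contradiction)
  open import Relation.Nullary.Decidable using (from-yes; from-no)
  open Congruence
  open Arithmetic
  open Fermat
  open Factors
  open LiftingTheExponent
  open Growth

  -- Modulo the least prime factor q of m, 8ᵐ ≡ −1 forces 64 ≡ 1, so q ∈ {3, 7}; but 8 ≡ 1 (mod 7).
  8^m≡-1⇒m≡1 : ∀ m → ¬ (2 ℕ.∣ m) → ¬ (3 ℕ.∣ m) → (∀ {q} → Prime q → q ℕ.∣ m → (+ 8) ^ m ≡ -1ℤ mod + q) → m ≡ 1
  8^m≡-1⇒m≡1 zero            2∤m _   _      = contradiction (ℕ.divides 0 refl) 2∤m
  8^m≡-1⇒m≡1 (suc zero)      _   _   _      = refl
  8^m≡-1⇒m≡1 m@(suc (suc _)) 2∤m 3∤m 8ᵐ≡-1 =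
    ⊥-elim ([ 3∤m ∘ (λ p≡3 → subst (ℕ._∣ m) p≡3 p∣n) , 7∤m ]′ (prime∣63 p-prime (∣⇒∣ᵤ (∣difference 64≡1))))
    where
    open LeastPrimeFactor (leastPrimeFactor m)
    64ᵐ≡1 : (+ 64) ^ m ≡ 1ℤ mod + p
    64ᵐ≡1 = mod-trans (≡⇒≡-mod (trans (^-*-assoc (+ 8) 2 m) (^-*-comm (+ 8) 2 m))) (^-cong-mod 2 (8ᵐ≡-1 p-prime p∣n))
    64≡1 : + 64 ≡ 1ℤ mod + p
    64≡1 = rough⇒^≡1⇒≡1 p-prime p-rough (+ 64) 64ᵐ≡1
    7∤m : p ≡ 7 → ⊥
    7∤m p≡7 = contradiction (ℕ.∣⇒≤ (∣⇒∣ᵤ (∣difference 1≡-1))) (from-no (7 ℕ.≤? 2))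
      where
      8≡1 : + 8 ≡ 1ℤ mod + 7
      8≡1 = modulo (divides 1ℤ refl)
      1≡-1 : 1ℤ ≡ -1ℤ mod + 7
      1≡-1 = mod-trans (mod-sym (^-cong-mod-1 m 8≡1)) (8ᵐ≡-1 (subst Prime p≡7 p-prime) (subst (ℕ._∣ m) p≡7 p∣n))

  odd-prime∣α-c : ∀ {p α′ c} → α′ ℕ.≤ 1 → Prime p → p ≢ 2 → Coprime (+ suc α′) c → ℤ.∣ c ∣ ℕ.≤ suc α′ →
                  + suc α′ ≢ c → + p ∣ + suc α′ - c → α′ ≡ 1 × c ≡ -1ℤ × p ≡ 3
  odd-prime∣α-c {α′ = 0} {+ 0}               _ p-prime _   _   _ _   p∣1 = contradiction p∣1 (prime∤1 p-prime)
  odd-prime∣α-c {α′ = 0} {+ 1}               _ _       _   _   _ α≢c _   = contradiction refl α≢c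
  odd-prime∣α-c {α′ = 0} {+ suc (suc _)}     _ _       _   _   (s≤s ()) _ _
  odd-prime∣α-c {α′ = 0} { -[1+ 0 ]}         _ p-prime p≢2 _   _ _   p∣2 =
    contradiction (prime∣prime⇒≡ prime[2] p-prime (∣⇒∣ᵤ p∣2)) p≢2
  odd-prime∣α-c {α′ = 0} { -[1+ suc _ ]}     _ _       _   _   (s≤s ()) _ _
  odd-prime∣α-c {α′ = 1} {+ 0}               _ _       _   2⊥0 _ _   _   with 2⊥0 (ℕ.∣-refl , ℕ.divides 0 refl)
  ... | ()
  odd-prime∣α-c {α′ = 1} {+ 1}               _ p-prime _   _   _ _   p∣1 = contradiction p∣1 (prime∤1 p-prime)
  odd-prime∣α-c {α′ = 1} {+ 2}               _ _       _   2⊥2 _ _   _   with 2⊥2 (ℕ.∣-refl , ℕ.∣-refl)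
  ... | ()
  odd-prime∣α-c {α′ = 1} {+ suc (suc (suc _))} _ _     _   _   (s≤s (s≤s ())) _ _
  odd-prime∣α-c {α′ = 1} { -[1+ 0 ]}         _ p-prime _   _   _ _   p∣3 =
    refl , refl , prime∣prime⇒≡ (from-yes (prime? 3)) p-prime (∣⇒∣ᵤ p∣3)
  odd-prime∣α-c {α′ = 1} { -[1+ 1 ]}         _ _       _   2⊥2 _ _   _   with 2⊥2 (ℕ.∣-refl , ℕ.∣-refl)
  ... | ()
  odd-prime∣α-c {α′ = 1} { -[1+ suc (suc _) ]} _ _     _   _   (s≤s (s≤s ())) _ _
  odd-prime∣α-c {α′ = suc (suc _)} (s≤s ())

  3^k≤4⇒k≤1 : ∀ k → 3 ℕ.^ (k ℕ.* 1) ℕ.≤ 4 → k ℕ.≤ 1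
  3^k≤4⇒k≤1 zero          _ = ℕ.z≤n
  3^k≤4⇒k≤1 (suc zero)    _ = ℕ.≤-refl
  3^k≤4⇒k≤1 (suc (suc k)) 9*3ᵏ≤4 =
    contradiction (ℕ.≤-trans (ℕ.*-monoʳ-≤ 3 (ℕ.*-monoʳ-≤ 3 (ℕ.m^n>0 3 (k ℕ.* 1)))) 9*3ᵏ≤4) (from-no (9 ℕ.≤? 4))

  rough-prime-lifting : ∀ {p n α c} .{{_ : NonZero n}} .{{_ : NonZero α}} → Prime p → p Rough n → p ℕ.∣ n → p ≢ 2 →
                        Coprime (+ α) c → (+ n) ^ α ∣ (+ α) ^ n - c ^ n → LiftingConditions p (+ α) c
  rough-prime-lifting {p} {n} {α} {c} p-prime rough p∣n p≢2 α⊥c nᵅ∣ = record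
    { p-prime = p-prime
    ; x≡y     = rough⇒^-cancel-mod p-prime rough α⊥c αⁿ≡cⁿ
    ; p∤x     = prime∤-coprime-powers p-prime α⊥c αⁿ≡cⁿ
    ; x≡y[4]  = λ p≡2 → contradiction p≡2 p≢2
    }
    where
    αⁿ≡cⁿ : (+ α) ^ n ≡ c ^ n mod + p
    αⁿ≡cⁿ = modulo (∣-trans (∣⇒∣^ {x = + n} α (∣ᵤ⇒∣ p∣n)) nᵅ∣)

  record OddExponentBase (α′ : ℕ) (c : ℤ) (n : ℕ) : Set where
    field
      α′≡1 : α′ ≡ 1
      c≡-1 : c ≡ -1ℤ
      m    : ℕ
      n≡3m : n ≡ 3 ℕ.* m
      3∤m  : ¬ (3 ℕ.∣ m)

  odd-exponent-base : ∀ {α′ c n} → 2 ℕ.≤ n → ¬ (2 ℕ.∣ n) → Coprime (+ suc α′) c → ℤ.∣ c ∣ ℕ.≤ suc α′ →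
                      + suc α′ ≢ c →
                      (+ n) ^ suc α′ ∣ (+ suc α′) ^ n - c ^ n → OddExponentBase α′ c n
  odd-exponent-base {α′} {c} {n} 2≤n 2∤n α⊥c ∣c∣≤α α≢c nᵅ∣ = record
    { α′≡1 = α′≡1 ; c≡-1 = c≡-1 ; m = m ; n≡3m = n≡3m ; 3∤m = 3∤m }
    where
    α : ℕ
    α = suc α′
    instance
      n-nonTrivial : ℕ.NonTrivial n
      n-nonTrivial = ℕ.n>1⇒nonTrivial 2≤n
      n≢0 : ℕ.NonZero n
      n≢0 = ℕ.nonTrivial⇒nonZero n
    open LeastPrimeFactor (leastPrimeFactor n)
    instance
      p≢0 : ℕ.NonZero p
      p≢0 = prime⇒nonZero p-prime
    open PowerSplit (p-adic-split (ℕ.nonTrivial⇒n>1 p {{prime⇒nonTrivial p-prime}}) n (ℕ.>-nonZero⁻¹ n))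
    p≢2 : p ≢ 2
    p≢2 p≡2 = 2∤n (subst (ℕ._∣ n) p≡2 p∣n)
    lifting : LiftingConditions p (+ α) c
    lifting = rough-prime-lifting p-prime p-rough p∣n p≢2 α⊥c nᵅ∣
    pᵏᵅ′≤2α : p ℕ.^ (k ℕ.* α′) ℕ.≤ 2 ℕ.* α
    pᵏᵅ′≤2α = ℕ.≤-trans
      (lte-bound k (k ℕ.* α′) lifting p∤m α≢c
        (subst₂ (λ e N → (+ p) ^ e ∣ (+ α) ^ N - c ^ N) (ℕ.*-suc k α′) n≡pᵏm (∣-trans (prime-power∣base-power k m α n≡pᵏm) nᵅ∣)))
      (ℕ.≤-trans (∣i-j∣≤∣i∣+∣j∣ (+ α) c) (ℕ.+-monoʳ-≤ α (subst (ℤ.∣ c ∣ ℕ.≤_) (sym (ℕ.+-identityʳ α)) ∣c∣≤α)))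
    1≤k : 1 ℕ.≤ k
    1≤k = ℕ.n≢0⇒n>0 λ k≡0 →
      p∤m (subst (p ℕ.∣_) (trans n≡pᵏm (trans (cong (λ e → p ℕ.^ e ℕ.* m) k≡0) (ℕ.*-identityˡ m))) p∣n)
    α′≤1 : α′ ℕ.≤ 1
    α′≤1 = ℕ.≮⇒≥ λ 2≤α′ → ℕ.<⇒≱ (2*[1+n]<3^n α′ 2≤α′) (begin
      3 ℕ.^ α′            ≤⟨ ℕ.^-monoˡ-≤ α′ (ℕ.≤∧≢⇒< (ℕ.nonTrivial⇒n>1 p {{prime⇒nonTrivial p-prime}}) (p≢2 ∘ sym)) ⟩
      p ℕ.^ α′            ≤⟨ ℕ.^-monoʳ-≤ p (ℕ.m≤n*m α′ k {{ℕ.>-nonZero 1≤k}}) ⟩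
      p ℕ.^ (k ℕ.* α′)    ≤⟨ pᵏᵅ′≤2α ⟩
      2 ℕ.* α             ∎)
      where open ℕ.≤-Reasoning
    small-case : α′ ≡ 1 × c ≡ -1ℤ × p ≡ 3
    small-case = odd-prime∣α-c α′≤1 p-prime p≢2 α⊥c ∣c∣≤α α≢c (∣difference (LiftingConditions.x≡y lifting))
    α′≡1 : α′ ≡ 1
    α′≡1 = proj₁ small-case
    c≡-1 : c ≡ -1ℤ
    c≡-1 = proj₁ (proj₂ small-case)
    p≡3 : p ≡ 3
    p≡3 = proj₂ (proj₂ small-case)
    k≡1 : k ≡ 1
    k≡1 = ℕ.≤-antisym
      (3^k≤4⇒k≤1 k (subst₂ (λ p α′ → p ℕ.^ (k ℕ.* α′) ℕ.≤ 2 ℕ.* suc α′) p≡3 α′≡1 pᵏᵅ′≤2α)) 1≤k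
    n≡3m : n ≡ 3 ℕ.* m
    n≡3m = trans n≡pᵏm (cong₂ (λ p k → p ℕ.^ k ℕ.* m) p≡3 k≡1)
    3∤m : ¬ (3 ℕ.∣ m)
    3∤m = subst (λ p → ¬ (p ℕ.∣ m)) p≡3 p∤m

  odd-exponent-closing : ∀ {α′ c n} m → α′ ≡ 1 → c ≡ -1ℤ → n ≡ 3 ℕ.* m → ¬ (3 ℕ.∣ m) → ¬ (2 ℕ.∣ n) →
                         (+ n) ^ suc α′ ∣ (+ suc α′) ^ n - c ^ n → n ≡ 3
  odd-exponent-closing m refl refl refl 3∤m 2∤n nᵅ∣ = cong (3 ℕ.*_) (8^m≡-1⇒m≡1 m 2∤m 3∤m 8ᵐ≡-1)
    where
    2∤m : ¬ (2 ℕ.∣ m)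
    2∤m 2∣m = 2∤n (ℕ.∣-trans 2∣m (ℕ.n∣m*n 3))
    8ᵐ≡-1 : ∀ {q} → Prime q → q ℕ.∣ m → (+ 8) ^ m ≡ -1ℤ mod + q
    8ᵐ≡-1 {q} _ q∣m =
      mod-trans (≡⇒≡-mod (^-*-assoc (+ 2) 3 m))
        (mod-trans (modulo (∣-trans (∣⇒∣^ {x = + (3 ℕ.* m)} 2 (∣ᵤ⇒∣ (ℕ.∣-trans q∣m (ℕ.n∣m*n 3)))) nᵅ∣))
          (≡⇒≡-mod (trans ([-x]^n≡-x^n 1ℤ 2∤n) (cong -_ (^-zeroˡ (3 ℕ.* m))))))

  odd-exponent : ∀ {α c n} → 2 ℕ.≤ n → ¬ (2 ℕ.∣ n) → 1 ℕ.≤ α → Coprime (+ α) c → ℤ.∣ c ∣ ℕ.≤ α → + α ≢ c →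
                 (+ n) ^ α ∣ (+ α) ^ n - c ^ n → α ≡ 2 × c ≡ -1ℤ × n ≡ 3
  odd-exponent {suc α′} {c} {n} 2≤n 2∤n _ α⊥c ∣c∣≤α α≢c nᵅ∣ =
    cong suc α′≡1 , c≡-1 , odd-exponent-closing m α′≡1 c≡-1 n≡3m 3∤m 2∤n nᵅ∣
    where open OddExponentBase (odd-exponent-base {α′} {c} {n} 2≤n 2∤n α⊥c ∣c∣≤α α≢c nᵅ∣)

module EvenExponent where

  open import Data.Nat as ℕ using (ℕ; zero; suc; s≤s; z≤n; NonZero)
  import Data.Nat.Properties as ℕ
  import Data.Nat.Divisibility as ℕ
  open import Data.Nat.Primality using (Prime; prime[2])
  open import Data.Integer as ℤ using (ℤ; +_; -_; _+_; _-_; _*_; _^_; 0ℤ; 1ℤ)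
  open import Data.Integer.Properties using (^-*-assoc; ^-zeroˡ; ^-identityʳ; +-inverseʳ; [+m]-[+n]≡m⊖n; ⊖-≥)
  open import Data.Integer.DivMod using (_%ℕ_; n%ℕd<d)
  open import Data.Integer.Divisibility.Signed using (_∣_; divides; ∣-trans; ∣⇒∣ᵤ; ∣ᵤ⇒∣; ∣m∣n⇒∣m-n)
  open import Data.Integer.Coprimality using (Coprime)
  import Data.Integer.Coprimality as Coprime
  open import Data.Integer.Tactic.RingSolver using (solve-∀)
  open import Data.Product using (Σ; _×_; _,_)
  open import Function using (_∘_)
  open import Relation.Binary.PropositionalEquality
  open import Relation.Nullary using (¬_; contradiction)
  open import Relation.Nullary.Decidable using (from-no)
  open Congruence
  open Arithmetic
  open Fermat
  open Factors
  open LiftingTheExponent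
  open Growth

  odd⇒≡1[2] : ∀ {u} → ¬ (+ 2 ∣ u) → u ≡ 1ℤ mod + 2
  odd⇒≡1[2] {u} 2∤u = residue (u %ℕ 2) (n%ℕd<d u 2) (≡-mod-%ℕ u 2)
    where
    residue : ∀ r → r ℕ.< 2 → u ≡ + r mod + 2 → u ≡ 1ℤ mod + 2
    residue 0 _ u≡0 = contradiction (≡0-mod⇒∣ u≡0) 2∤u
    residue 1 _ u≡1 = u≡1
    residue (suc (suc _)) (s≤s (s≤s ()))

  odd²≡1[4] : ∀ {u} → ¬ (+ 2 ∣ u) → u ^ 2 ≡ 1ℤ mod + 4
  odd²≡1[4] {u} 2∤u = modulo (divides (q * q + q) (begin
    u ^ 2 - 1ℤ                       ≡⟨ factor u ⟩
    (u - 1ℤ) * (u - 1ℤ + + 2)        ≡⟨ cong (λ d → d * (d + + 2)) u-1≡2q ⟩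
    q * + 2 * (q * + 2 + + 2)        ≡⟨ expand q ⟩
    (q * q + q) * + 4                ∎))
    where
    open ≡-Reasoning
    open _∣_ (∣difference (odd⇒≡1[2] 2∤u)) renaming (quotient to q; equality to u-1≡2q)
    factor : ∀ u → u * (u * 1ℤ) - 1ℤ ≡ (u - 1ℤ) * (u - 1ℤ + + 2)
    factor = solve-∀
    expand : ∀ q → q * + 2 * (q * + 2 + + 2) ≡ (q * q + q) * + 4
    expand = solve-∀

  odd^even≡1[4] : ∀ {u n} → ¬ (+ 2 ∣ u) → 2 ℕ.∣ n → u ^ n ≡ 1ℤ mod + 4
  odd^even≡1[4] {u} 2∤u (ℕ.divides j refl) =
    mod-trans (≡⇒≡-mod (sym (^-*-assoc u j 2))) (odd²≡1[4] (2∤u ∘ prime∣^⇒∣ prime[2] j))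

  2∣x+y⇒x≡y[2] : ∀ {x y} → + 2 ∣ x + y → x ≡ y mod + 2
  2∣x+y⇒x≡y[2] {x} {y} 2∣x+y = modulo (subst (+ 2 ∣_) (cancel x y) (∣m∣n⇒∣m-n 2∣x+y (divides y refl)))
    where
    cancel : ∀ x y → x + y - y * + 2 ≡ x - y
    cancel = solve-∀

  odd-coprime-powers : ∀ {x y n} → Coprime x y → .{{NonZero n}} → x ^ n ≡ y ^ n mod + 2 → ¬ (+ 2 ∣ x) × ¬ (+ 2 ∣ y)
  odd-coprime-powers {x} {y} x⊥y xⁿ≡yⁿ =
    prime∤-coprime-powers prime[2] x⊥y xⁿ≡yⁿ , prime∤-coprime-powers prime[2] (Coprime.sym {x} {y} x⊥y) (mod-sym xⁿ≡yⁿ)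

  4∣2^[2+a] : ∀ a → + 4 ∣ (+ 2) ^ suc (suc a)
  4∣2^[2+a] a = divides ((+ 2) ^ a) (regroup ((+ 2) ^ a))
    where
    regroup : ∀ z → + 2 * (+ 2 * z) ≡ z * + 4
    regroup = solve-∀

  even-exponent-plus-cases : ∀ {α β n} → 2 ℕ.≤ n → 2 ℕ.∣ n → 1 ℕ.≤ α → β ℕ.≤ α → ¬ (+ 2 ∣ + β) →
                             (+ α) ^ n + (+ β) ^ n ≡ + 2 mod + 4 → (+ n) ^ α ∣ (+ α) ^ n + (+ β) ^ n →
                             α ≡ 1 × β ≡ 1 × n ≡ 2
  even-exponent-plus-cases {1} {0} _ _ _ _ 2∤β _ _ = contradiction (divides 0ℤ refl) 2∤β
  even-exponent-plus-cases {1} {1} {n} 2≤n _ _ _ _ _ n∣2 =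
    refl , refl , ℕ.≤-antisym (ℕ.∣⇒≤ (∣⇒∣ᵤ (subst₂ _∣_ (^-identityʳ (+ n)) (cong₂ _+_ (^-zeroˡ n) (^-zeroˡ n)) n∣2))) 2≤n
  even-exponent-plus-cases {1} {suc (suc _)} _ _ _ (s≤s ())
  even-exponent-plus-cases {suc (suc a)} {β} {n} _ 2∣n _ _ _ sum≡2 nᵅ∣sum =
    contradiction (∣⇒∣ᵤ (∣difference (mod-trans (mod-sym sum≡2) sum≡0))) (from-no (4 ℕ.∣? 2))
    where
    sum≡0 : (+ suc (suc a)) ^ n + (+ β) ^ n ≡ 0ℤ mod + 4
    sum≡0 = ∣⇒≡0-mod (∣-trans (4∣2^[2+a] a) (∣-trans (^-mono-∣ {+ 2} {+ n} (suc (suc a)) (∣ᵤ⇒∣ 2∣n)) nᵅ∣sum))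

  even-exponent-plus : ∀ {α β n} → 2 ℕ.≤ n → 2 ℕ.∣ n → 1 ℕ.≤ α → Coprime (+ α) (+ β) → β ℕ.≤ α →
                       (+ n) ^ α ∣ (+ α) ^ n + (+ β) ^ n → α ≡ 1 × β ≡ 1 × n ≡ 2
  even-exponent-plus {α} {β} {n} 2≤n 2∣n 1≤α α⊥β β≤α nᵅ∣sum =
    even-exponent-plus-cases 2≤n 2∣n 1≤α β≤α 2∤β (+-cong-mod (odd^even≡1[4] 2∤α 2∣n) (odd^even≡1[4] 2∤β 2∣n)) nᵅ∣sum
    where
    instance
      α≢0 : NonZero α
      α≢0 = ℕ.>-nonZero 1≤α
      n≢0 : NonZero n
      n≢0 = ℕ.>-nonZero (ℕ.<-trans (s≤s z≤n) 2≤n)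
    open Σ (odd-coprime-powers {n = n} α⊥β (2∣x+y⇒x≡y[2] (∣-trans (∣⇒∣^ {x = + n} α (∣ᵤ⇒∣ 2∣n)) nᵅ∣sum)))
      renaming (proj₁ to 2∤α; proj₂ to 2∤β)

  2^a<a²⇒a≡3 : ∀ a → 2 ℕ.^ a ℕ.< a ℕ.^ 2 → a ≡ 3
  2^a<a²⇒a≡3 0 ()
  2^a<a²⇒a≡3 1 (s≤s ())
  2^a<a²⇒a≡3 2 4<4 = contradiction 4<4 (ℕ.<-irrefl refl)
  2^a<a²⇒a≡3 3 _ = refl
  2^a<a²⇒a≡3 4 16<16 = contradiction 16<16 (ℕ.<-irrefl refl)
  2^a<a²⇒a≡3 a@(suc (suc (suc (suc (suc _))))) 2ᵃ<a² =
    contradiction 2ᵃ<a² (ℕ.<⇒≯ (subst (ℕ._< 2 ℕ.^ a) (cong (a ℕ.*_) (sym (ℕ.*-identityʳ a)))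
                                 (n*n<2^n a (s≤s (s≤s (s≤s (s≤s (s≤s z≤n))))))))

  2^[3+2k]≤8⇒k≡0 : ∀ k → 2 ℕ.^ (3 ℕ.+ k ℕ.* 2) ℕ.≤ 8 → k ≡ 0
  2^[3+2k]≤8⇒k≡0 zero    _ = refl
  2^[3+2k]≤8⇒k≡0 (suc k) 2⁵⁺²ᵏ≤8 =
    contradiction (ℕ.≤-trans (ℕ.^-monoʳ-≤ 2 (ℕ.m≤m+n 5 (k ℕ.* 2))) 2⁵⁺²ᵏ≤8) (from-no (32 ℕ.≤? 8))

  odd≤3⇒≡1 : ∀ {β} → β ℕ.≤ 3 → ¬ (+ 2 ∣ + β) → β ≢ 3 → β ≡ 1
  odd≤3⇒≡1 {0} _ 2∤β _ = contradiction (divides 0ℤ refl) 2∤β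
  odd≤3⇒≡1 {1} _ _ _ = refl
  odd≤3⇒≡1 {2} _ 2∤β _ = contradiction (divides 1ℤ refl) 2∤β
  odd≤3⇒≡1 {3} _ _ β≢3 = contradiction refl β≢3
  odd≤3⇒≡1 {suc (suc (suc (suc _)))} (s≤s (s≤s (s≤s ())))

  odd²-lifting : ∀ {x y} → ¬ (+ 2 ∣ x) → ¬ (+ 2 ∣ y) → LiftingConditions 2 (x ^ 2) (y ^ 2)
  odd²-lifting {x} {y} 2∤x 2∤y = record
    { p-prime = prime[2]
    ; x≡y     = mod-weaken (divides (+ 2) refl) x²≡y²
    ; p∤x     = 2∤x ∘ prime∣^⇒∣ prime[2] 2
    ; x≡y[4]  = λ _ → x²≡y²
    }
    where
    x²≡y² : x ^ 2 ≡ y ^ 2 mod + 4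
    x²≡y² = mod-trans (odd²≡1[4] 2∤x) (mod-sym (odd²≡1[4] 2∤y))

  ∣α²-β²∣≡α²∸β² : ∀ {α β} → β ℕ.≤ α → ℤ.∣ (+ α) ^ 2 - (+ β) ^ 2 ∣ ≡ α ℕ.^ 2 ℕ.∸ β ℕ.^ 2
  ∣α²-β²∣≡α²∸β² {α} {β} β≤α = cong ℤ.∣_∣ (trans (cong₂ _-_ (sym (pos-^ α 2)) (sym (pos-^ β 2)))
    (trans ([+m]-[+n]≡m⊖n (α ℕ.^ 2) (β ℕ.^ 2)) (⊖-≥ (ℕ.^-monoˡ-≤ 2 β≤α))))

  record EvenMinusBase (α β n : ℕ) : Set where
    field
      α≡3  : α ≡ 3
      β≡1  : β ≡ 1
      m    : ℕ
      n≡2m : n ≡ 2 ℕ.* m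
      2∤m  : ¬ (2 ℕ.∣ m)

  even-exponent-minus-base : ∀ {α′ β n} .{{_ : NonZero n}} k m → n ≡ 2 ℕ.^ k ℕ.* m → ¬ (2 ℕ.∣ m) → 2 ℕ.∣ n →
                             Coprime (+ suc α′) (+ β) → β ℕ.≤ suc α′ → suc α′ ≢ β →
                             (+ n) ^ suc α′ ∣ (+ suc α′) ^ n - (+ β) ^ n → EvenMinusBase (suc α′) β n
  even-exponent-minus-base zero m n≡m 2∤m 2∣n _ _ _ _ = contradiction (subst (2 ℕ.∣_) (trans n≡m (ℕ.*-identityˡ m)) 2∣n) 2∤m
  even-exponent-minus-base {α′} {β} {n} (suc k′) m n≡2ᵏm 2∤m 2∣n α⊥β β≤α α≢β nᵅ∣ = record
    { α≡3 = α≡3 ; β≡1 = β≡1 ; m = m ; n≡2m = trans n≡2ᵏm (cong (λ k → 2 ℕ.^ suc k ℕ.* m) k′≡0) ; 2∤m = 2∤m }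
    where
    α : ℕ
    α = suc α′
    open Σ (odd-coprime-powers {n = n} α⊥β (modulo (∣-trans (∣⇒∣^ {x = + n} α (∣ᵤ⇒∣ 2∣n)) nᵅ∣)))
      renaming (proj₁ to 2∤α; proj₂ to 2∤β)
    x y : ℤ
    x = (+ α) ^ 2
    y = (+ β) ^ 2
    β<α : β ℕ.< α
    β<α = ℕ.≤∧≢⇒< β≤α (λ β≡α → α≢β (sym β≡α))
    ∣x-y∣≡α²-β² : ℤ.∣ x - y ∣ ≡ α ℕ.^ 2 ℕ.∸ β ℕ.^ 2
    ∣x-y∣≡α²-β² = ∣α²-β²∣≡α²∸β² β≤α
    x≢y : x ≢ y
    x≢y x≡y = ℕ.m>n⇒m∸n≢0 (ℕ.^-monoˡ-< 2 β<α)
      (trans (sym ∣x-y∣≡α²-β²) (cong ℤ.∣_∣ (trans (cong (_- y) x≡y) (+-inverseʳ y))))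
    bound : 2 ℕ.^ (α ℕ.+ k′ ℕ.* α′) ℕ.≤ α ℕ.^ 2 ℕ.∸ β ℕ.^ 2
    bound = subst (2 ℕ.^ (α ℕ.+ k′ ℕ.* α′) ℕ.≤_) ∣x-y∣≡α²-β²
      (lte-bound k′ (α ℕ.+ k′ ℕ.* α′) (odd²-lifting 2∤α 2∤β) 2∤m x≢y
        (subst₂ (λ e N → (+ 2) ^ e ∣ N) (exponent k′ α′) (cong₂ _-_ (square-power (+ α)) (square-power (+ β)))
          (∣-trans (prime-power∣base-power (suc k′) m α n≡2ᵏm) nᵅ∣)))
      where
      exponent : ∀ k a → suc k ℕ.* suc a ≡ k ℕ.+ (suc a ℕ.+ k ℕ.* a)
      exponent = NatSolver.solve-∀
        where import Data.Nat.Tactic.RingSolver as NatSolver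
      square-power : ∀ z → z ^ n ≡ (z ^ 2) ^ (2 ℕ.^ k′ ℕ.* m)
      square-power z = trans (cong (z ^_) (trans n≡2ᵏm (ℕ.*-assoc 2 (2 ℕ.^ k′) m))) (sym (^-*-assoc z 2 (2 ℕ.^ k′ ℕ.* m)))
    α≡3 : α ≡ 3
    α≡3 = 2^a<a²⇒a≡3 α (begin-strict
      2 ℕ.^ α                  ≤⟨ ℕ.^-monoʳ-≤ 2 (ℕ.m≤m+n α (k′ ℕ.* α′)) ⟩
      2 ℕ.^ (α ℕ.+ k′ ℕ.* α′)  ≤⟨ bound ⟩
      α ℕ.^ 2 ℕ.∸ β ℕ.^ 2      <⟨ ℕ.∸-monoʳ-< (ℕ.m^n>0 β {{ℕ.>-nonZero β>0}} 2) (ℕ.^-monoˡ-≤ 2 β≤α) ⟩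
      α ℕ.^ 2 ℕ.∸ 0            ≡⟨⟩
      α ℕ.^ 2                  ∎)
      where
      open ℕ.≤-Reasoning
      β>0 : 0 ℕ.< β
      β>0 = ℕ.n≢0⇒n>0 (λ β≡0 → 2∤β (subst (λ b → + 2 ∣ + b) (sym β≡0) (divides 0ℤ refl)))
    β≡1 : β ≡ 1
    β≡1 = odd≤3⇒≡1 (subst (β ℕ.≤_) α≡3 β≤α) 2∤β (λ β≡3 → α≢β (trans α≡3 (sym β≡3)))
    k′≡0 : k′ ≡ 0
    k′≡0 = 2^[3+2k]≤8⇒k≡0 k′
      (subst₂ (λ a b → 2 ℕ.^ (suc a ℕ.+ k′ ℕ.* a) ℕ.≤ suc a ℕ.^ 2 ℕ.∸ b ℕ.^ 2) (ℕ.suc-injective α≡3) β≡1 bound)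

  9^m≡1⇒m≡1 : ∀ m → ¬ (2 ℕ.∣ m) → (∀ {q} → Prime q → q ℕ.∣ m → (+ 9) ^ m ≡ 1ℤ mod + q) → m ≡ 1
  9^m≡1⇒m≡1 zero            2∤m _     = contradiction (ℕ.divides 0 refl) 2∤m
  9^m≡1⇒m≡1 (suc zero)      _   _     = refl
  9^m≡1⇒m≡1 m@(suc (suc _)) 2∤m 9ᵐ≡1 = contradiction (subst (ℕ._∣ m) p≡2 p∣n) 2∤m
    where
    open LeastPrimeFactor (leastPrimeFactor m)
    p≡2 : p ≡ 2
    p≡2 = prime∣8⇒≡2 p-prime (∣⇒∣ᵤ (∣difference (rough⇒^≡1⇒≡1 p-prime p-rough (+ 9) (9ᵐ≡1 p-prime p∣n))))

  even-exponent-minus-closing : ∀ {α β n} m → α ≡ 3 → β ≡ 1 → n ≡ 2 ℕ.* m → ¬ (2 ℕ.∣ m) →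
                                (+ n) ^ α ∣ (+ α) ^ n - (+ β) ^ n → n ≡ 2
  even-exponent-minus-closing m refl refl refl 2∤m nᵅ∣ = cong (2 ℕ.*_) (9^m≡1⇒m≡1 m 2∤m 9ᵐ≡1)
    where
    9ᵐ≡1 : ∀ {q} → Prime q → q ℕ.∣ m → (+ 9) ^ m ≡ 1ℤ mod + q
    9ᵐ≡1 _ q∣m =
      mod-trans (≡⇒≡-mod (^-*-assoc (+ 3) 2 m))
        (mod-trans (modulo (∣-trans (∣⇒∣^ {x = + (2 ℕ.* m)} 3 (∣ᵤ⇒∣ (ℕ.∣-trans q∣m (ℕ.n∣m*n 2)))) nᵅ∣))
          (≡⇒≡-mod (^-zeroˡ (2 ℕ.* m))))

  even-exponent-minus : ∀ {α β n} → 2 ℕ.≤ n → 2 ℕ.∣ n → 1 ℕ.≤ α → Coprime (+ α) (+ β) → β ℕ.≤ α → α ≢ β →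
                        (+ n) ^ α ∣ (+ α) ^ n - (+ β) ^ n → α ≡ 3 × β ≡ 1 × n ≡ 2
  even-exponent-minus {suc α′} {β} {n} 2≤n 2∣n _ α⊥β β≤α α≢β nᵅ∣ =
    α≡3 , β≡1 , even-exponent-minus-closing m α≡3 β≡1 n≡2m 2∤m nᵅ∣
    where
    instance
      n≢0 : NonZero n
      n≢0 = ℕ.>-nonZero (ℕ.<-trans (s≤s z≤n) 2≤n)
    open PowerSplit (p-adic-split (s≤s (s≤s z≤n)) n (ℕ.>-nonZero⁻¹ n)) using (k)
      renaming (m to r; n≡pᵏm to n≡2ᵏr; p∤m to 2∤r)
    open EvenMinusBase (even-exponent-minus-base k r n≡2ᵏr 2∤r 2∣n α⊥β β≤α α≢β nᵅ∣)

module Scaling where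

  open import Data.Nat as ℕ using (ℕ; suc; _≤_; s≤s; z≤n)
  import Data.Nat.Properties as ℕ
  import Data.Nat.Divisibility as ℕ
  open import Data.Integer as ℤ using (ℤ; +_; -_; _+_; _-_; _*_; _^_; ∣_∣)
  open import Data.Integer.Properties using (abs-*; pos-*; *-identityˡ)
  open import Data.Integer.Divisibility using (_∣_)
  open import Data.Integer.Tactic.RingSolver using (solve-∀)
  open import Data.Product using (∃; _×_; _,_)
  open import Relation.Binary.PropositionalEquality
  open import Relation.Nullary using (¬_; contradiction)
  open import Relation.Nullary.Decidable using (from-no)
  open Arithmetic using (pos-^)
  open Growth

  9^d∣9d³⇒d≡1 : ∀ d → 1 ≤ d → 9 ℕ.^ d ℕ.∣ 9 ℕ.* (d ℕ.* d ℕ.* d) → d ≡ 1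
  9^d∣9d³⇒d≡1 1             _ _     = refl
  9^d∣9d³⇒d≡1 (suc (suc d)) _ 9ᵈ∣ = contradiction (ℕ.∣⇒≤ 9ᵈ∣) (ℕ.<⇒≱ (9*n³<9^n (2 ℕ.+ d) (s≤s (s≤s z≤n))))

  8^d∣8d²⇒d≡1 : ∀ d → 1 ≤ d → 8 ℕ.^ d ℕ.∣ 8 ℕ.* (d ℕ.* d) → d ≡ 1
  8^d∣8d²⇒d≡1 1             _ _     = refl
  8^d∣8d²⇒d≡1 (suc (suc d)) _ 8ᵈ∣ = contradiction (ℕ.∣⇒≤ 8ᵈ∣) (ℕ.<⇒≱ (8*n²<8^n (2 ℕ.+ d) (s≤s (s≤s z≤n))))

  2^d∣2d²⇒d≡2^c : ∀ d → 1 ≤ d → 2 ℕ.^ d ℕ.∣ 2 ℕ.* (d ℕ.* d) → ∃ λ c → c ≤ 2 × d ≡ 2 ℕ.^ c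
  2^d∣2d²⇒d≡2^c 1 _ _ = 0 , z≤n , refl
  2^d∣2d²⇒d≡2^c 2 _ _ = 1 , s≤s z≤n , refl
  2^d∣2d²⇒d≡2^c 3 _ 8∣18 = contradiction 8∣18 (from-no (8 ℕ.∣? 18))
  2^d∣2d²⇒d≡2^c 4 _ _ = 2 , s≤s (s≤s z≤n) , refl
  2^d∣2d²⇒d≡2^c 5 _ 32∣50 = contradiction 32∣50 (from-no (32 ℕ.∣? 50))
  2^d∣2d²⇒d≡2^c 6 _ 64∣72 = contradiction 64∣72 (from-no (64 ℕ.∣? 72))
  2^d∣2d²⇒d≡2^c d@(suc (suc (suc (suc (suc (suc (suc _))))))) _ 2ᵈ∣ =
    contradiction (ℕ.∣⇒≤ 2ᵈ∣) (ℕ.<⇒≱ (2*n²<2^n d (s≤s (s≤s (s≤s (s≤s (s≤s (s≤s (s≤s z≤n)))))))))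

  ∣k*d²∣ : ∀ k d → ∣ + k * (+ d * + d) ∣ ≡ k ℕ.* (d ℕ.* d)
  ∣k*d²∣ k d = trans (abs-* (+ k) _) (cong (k ℕ.*_) (abs-* (+ d) (+ d)))

  ∣k*d³∣ : ∀ k d → ∣ + k * (+ d * + d * + d) ∣ ≡ k ℕ.* (d ℕ.* d ℕ.* d)
  ∣k*d³∣ k d = trans (abs-* (+ k) _) (cong (k ℕ.*_) (trans (abs-* (+ d * + d) (+ d)) (cong (ℕ._* d) (abs-* (+ d) (+ d)))))

  scaled-odd-sum : ∀ {a b n α δ} {β : ℤ} → a ≡ α ℕ.* δ → b ≡ β * + δ → 1 ≤ δ → α ≡ 2 → β ≡ + 1 → n ≡ 3 →
                   (+ n) ^ a ∣ (+ a) ^ n + b ^ n → a ≡ 2 × b ≡ + 1 × n ≡ 3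
  scaled-odd-sum {δ = δ} refl refl 1≤δ refl refl refl 3²ᵟ∣ = cong (2 ℕ.*_) δ≡1 , cong (λ d → + 1 * + d) δ≡1 , refl
    where
    cubes : ∀ x → let y = + 2 * x; z = + 1 * x in y * (y * (y * + 1)) + z * (z * (z * + 1)) ≡ + 9 * (x * x * x)
    cubes = solve-∀
    δ≡1 : δ ≡ 1
    δ≡1 = 9^d∣9d³⇒d≡1 δ 1≤δ (subst₂ ℕ._∣_
      (trans (cong ∣_∣ (sym (pos-^ 3 (2 ℕ.* δ)))) (sym (ℕ.^-*-assoc 3 2 δ)))
      (trans (cong ∣_∣ (trans (cong (λ x → x ^ 3 + (+ 1 * + δ) ^ 3) (pos-* 2 δ)) (cubes (+ δ)))) (∣k*d³∣ 9 δ))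
      3²ᵟ∣)

  scaled-odd-difference : ∀ {a b n α δ} {β : ℤ} → a ≡ α ℕ.* δ → b ≡ β * + δ → 1 ≤ δ → α ≡ 2 → β ≡ - (+ 1) → n ≡ 3 →
                          (+ n) ^ a ∣ (+ a) ^ n - b ^ n → a ≡ 2 × b ≡ - (+ 1) × n ≡ 3
  scaled-odd-difference {δ = δ} refl refl 1≤δ refl refl refl 3²ᵟ∣ = cong (2 ℕ.*_) δ≡1 , cong (λ d → - (+ 1) * + d) δ≡1 , refl
    where
    cubes : ∀ x → let y = + 2 * x; z = - (+ 1) * x in y * (y * (y * + 1)) - z * (z * (z * + 1)) ≡ + 9 * (x * x * x)
    cubes = solve-∀
    δ≡1 : δ ≡ 1
    δ≡1 = 9^d∣9d³⇒d≡1 δ 1≤δ (subst₂ ℕ._∣_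
      (trans (cong ∣_∣ (sym (pos-^ 3 (2 ℕ.* δ)))) (sym (ℕ.^-*-assoc 3 2 δ)))
      (trans (cong ∣_∣ (trans (cong (λ x → x ^ 3 - (- (+ 1) * + δ) ^ 3) (pos-* 2 δ)) (cubes (+ δ)))) (∣k*d³∣ 9 δ))
      3²ᵟ∣)

  scaled-even-sum : ∀ {a b n α δ} {β : ℤ} → a ≡ α ℕ.* δ → b ≡ β * + δ → 1 ≤ δ → α ≡ 1 → β ≡ + 1 → n ≡ 2 →
                    (+ n) ^ a ∣ (+ a) ^ n + b ^ n → ∃ λ c → c ≤ 2 × a ≡ 2 ℕ.^ c × b ≡ + (2 ℕ.^ c) × n ≡ 2
  scaled-even-sum {δ = δ} refl refl 1≤δ refl refl refl 2ᵟ∣ =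
    let (c , c≤2 , δ≡2ᶜ) = 2^d∣2d²⇒d≡2^c δ 1≤δ 2ᵟ∣2δ²
    in c , c≤2 , trans (ℕ.*-identityˡ δ) δ≡2ᶜ , trans (*-identityˡ (+ δ)) (cong +_ δ≡2ᶜ) , refl
    where
    squares : ∀ x → let z = + 1 * x in z * (z * + 1) + z * (z * + 1) ≡ + 2 * (x * x)
    squares = solve-∀
    2ᵟ∣2δ² : 2 ℕ.^ δ ℕ.∣ 2 ℕ.* (δ ℕ.* δ)
    2ᵟ∣2δ² = subst₂ ℕ._∣_
      (trans (cong ∣_∣ (sym (pos-^ 2 (1 ℕ.* δ)))) (cong (2 ℕ.^_) (ℕ.*-identityˡ δ)))
      (trans (cong ∣_∣ (trans (cong (λ x → x ^ 2 + (+ 1 * + δ) ^ 2) (pos-* 1 δ)) (squares (+ δ)))) (∣k*d²∣ 2 δ))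
      2ᵟ∣

  scaled-even-difference : ∀ {a b n α δ} {β : ℤ} → a ≡ α ℕ.* δ → b ≡ β * + δ → 1 ≤ δ → α ≡ 3 → β ≡ + 1 → n ≡ 2 →
                           (+ n) ^ a ∣ (+ a) ^ n - b ^ n → a ≡ 3 × b ≡ + 1 × n ≡ 2
  scaled-even-difference {δ = δ} refl refl 1≤δ refl refl refl 2³ᵟ∣ = cong (3 ℕ.*_) δ≡1 , cong (λ d → + 1 * + d) δ≡1 , refl
    where
    squares : ∀ x → let y = + 3 * x; z = + 1 * x in y * (y * + 1) - z * (z * + 1) ≡ + 8 * (x * x)
    squares = solve-∀
    δ≡1 : δ ≡ 1
    δ≡1 = 8^d∣8d²⇒d≡1 δ 1≤δ (subst₂ ℕ._∣_
      (trans (cong ∣_∣ (sym (pos-^ 2 (3 ℕ.* δ)))) (sym (ℕ.^-*-assoc 2 3 δ)))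
      (trans (cong ∣_∣ (trans (cong (λ x → x ^ 2 - (+ 1 * + δ) ^ 2) (pos-* 3 δ)) (squares (+ δ)))) (∣k*d²∣ 8 δ))
      2³ᵟ∣)

open import Defs
open import Data.Nat as ℕ using (ℕ; _≤_; suc)
import Data.Nat.Coprimality as ℕ
open import Data.Nat.Divisibility as ℕD using ()
open import Data.Integer as ℤ using (ℤ; +_; -_; ∣_∣; _^_; _+_; _-_; _≥_; 0ℤ)
open import Data.Integer.Properties using (∣-i∣≡∣i∣; neg-involutive; neg-injective)
import Data.Integer.Coprimality as ℤ
open import Data.Integer.Divisibility using (_∣_)
import Data.Integer.Divisibility.Signed as Signed
open import Data.Integer.Tactic.RingSolver using (solve-∀)
open import Data.Product using (_×_; ∃; _,_)
open import Data.Sum using (_⊎_; inj₁; inj₂)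
open import Function.Bundles using (_⇔_; mk⇔)
open import Relation.Binary.PropositionalEquality using (_≡_; _≢_; refl; sym; trans; cong; subst)
open import Relation.Nullary using (¬_; yes; no)
open Arithmetic using ([-x]^n≡-x^n)
open OddExponent using (odd-exponent)
open EvenExponent using (even-exponent-plus; even-exponent-minus)
open Scaling
open Reduction

Solutions₁ : ℕ → ℤ → ℕ → Set
Solutions₁ a b n = (a ≡ 2 × b ≡ + 1 × n ≡ 3) ⊎ ∃ λ c → c ≤ 2 × a ≡ 2 ℕ.^ c × b ≡ + (2 ℕ.^ c) × n ≡ 2

Solutions₂ : ℕ → ℤ → ℕ → Set
Solutions₂ a b n = (a ≡ 3 × b ≡ + 1 × n ≡ 2) ⊎ (a ≡ 2 × b ≡ - (+ 1) × n ≡ 3)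

module _ (a : ℕ) (b : ℤ) (n : ℕ) (2≤n : 2 ≤ n) (1≤a : 1 ≤ a) (∣b∣≤a : ∣ b ∣ ≤ a) where

  forward₁-odd : ¬ (2 ℕD.∣ n) → β a b ≢ - (+ α a b) →
                 (+ n) ^ a ∣ (+ a) ^ n + b ^ n → (+ n) ^ α a b ∣ (+ α a b) ^ n + (β a b) ^ n → a ≡ 2 × b ≡ + 1 × n ≡ 3
  forward₁-odd 2∤n β≢-α H₁ H₂ =
    let (α≡2 , -β≡-1 , n≡3) = odd-exponent 2≤n 2∤n (1≤α a b 1≤a) α⊥-β ∣-β∣≤α α≢-β H₂′
    in scaled-odd-sum (a≡α*δ a b 1≤a) (b≡β*δ a b 1≤a) (1≤δ a b 1≤a) α≡2 (neg-injective -β≡-1) n≡3 H₁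
    where
    ∣-β∣≡∣β∣ : ∣ - β a b ∣ ≡ ∣ β a b ∣
    ∣-β∣≡∣β∣ = ∣-i∣≡∣i∣ (β a b)
    α⊥-β : ℤ.Coprime (+ α a b) (- β a b)
    α⊥-β = subst (ℕ.Coprime (α a b)) (sym ∣-β∣≡∣β∣) (α⊥β a b 1≤a)
    ∣-β∣≤α : ∣ - β a b ∣ ≤ α a b
    ∣-β∣≤α = subst (_≤ α a b) (sym ∣-β∣≡∣β∣) (∣β∣≤α a b 1≤a ∣b∣≤a)
    α≢-β : + α a b ≢ - β a b
    α≢-β α≡-β = β≢-α (trans (sym (neg-involutive (β a b))) (cong -_ (sym α≡-β)))
    H₂′ : (+ n) ^ α a b Signed.∣ (+ α a b) ^ n - (- β a b) ^ n
    H₂′ = subst (Signed._∣_ _) (sym (trans (cong (λ z → (+ α a b) ^ n - z) ([-x]^n≡-x^n (β a b) 2∤n))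
                                        (minus-neg ((+ α a b) ^ n) (β a b ^ n)))) (Signed.∣ᵤ⇒∣ H₂)
      where
      minus-neg : ∀ x y → x - - y ≡ x + y
      minus-neg = solve-∀

  forward₁-even : 2 ℕD.∣ n → b ≥ 0ℤ →
                  (+ n) ^ a ∣ (+ a) ^ n + b ^ n → (+ n) ^ α a b ∣ (+ α a b) ^ n + (β a b) ^ n →
                  ∃ λ c → c ≤ 2 × a ≡ 2 ℕ.^ c × b ≡ + (2 ℕ.^ c) × n ≡ 2
  forward₁-even 2∣n 0≤b H₁ H₂ =
    let (α≡1 , ∣β∣≡1 , n≡2) = even-exponent-plus 2≤n 2∣n (1≤α a b 1≤a) (α⊥β a b 1≤a) (∣β∣≤α a b 1≤a ∣b∣≤a) H₂′
    in scaled-even-sum (a≡α*δ a b 1≤a) (b≡β*δ a b 1≤a) (1≤δ a b 1≤a) α≡1 (trans β≡+∣β∣ (cong +_ ∣β∣≡1)) n≡2 H₁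
    where
    β≡+∣β∣ : β a b ≡ + ∣ β a b ∣
    β≡+∣β∣ = 0≤b⇒β≡+∣β∣ a b 0≤b
    H₂′ : (+ n) ^ α a b Signed.∣ (+ α a b) ^ n + (+ ∣ β a b ∣) ^ n
    H₂′ = subst (λ z → (+ n) ^ α a b Signed.∣ (+ α a b) ^ n + z ^ n) β≡+∣β∣ (Signed.∣ᵤ⇒∣ H₂)

  forward₂-odd : ¬ (2 ℕD.∣ n) → β a b ≢ + α a b →
                 (+ n) ^ a ∣ (+ a) ^ n - b ^ n → (+ n) ^ α a b ∣ (+ α a b) ^ n - (β a b) ^ n → a ≡ 2 × b ≡ - (+ 1) × n ≡ 3
  forward₂-odd 2∤n β≢α H₁ H₂ =
    let (α≡2 , β≡-1 , n≡3) = odd-exponent 2≤n 2∤n (1≤α a b 1≤a) (α⊥β a b 1≤a) (∣β∣≤α a b 1≤a ∣b∣≤a)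
                               (λ α≡β → β≢α (sym α≡β)) (Signed.∣ᵤ⇒∣ H₂)
    in scaled-odd-difference (a≡α*δ a b 1≤a) (b≡β*δ a b 1≤a) (1≤δ a b 1≤a) α≡2 β≡-1 n≡3 H₁

  forward₂-even : 2 ℕD.∣ n → b ≥ 0ℤ → β a b ≢ + α a b →
                  (+ n) ^ a ∣ (+ a) ^ n - b ^ n → (+ n) ^ α a b ∣ (+ α a b) ^ n - (β a b) ^ n → a ≡ 3 × b ≡ + 1 × n ≡ 2
  forward₂-even 2∣n 0≤b β≢α H₁ H₂ =
    let (α≡3 , ∣β∣≡1 , n≡2) =
          even-exponent-minus 2≤n 2∣n (1≤α a b 1≤a) (α⊥β a b 1≤a) (∣β∣≤α a b 1≤a ∣b∣≤a) α≢∣β∣ H₂′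
    in scaled-even-difference (a≡α*δ a b 1≤a) (b≡β*δ a b 1≤a) (1≤δ a b 1≤a) α≡3 (trans β≡+∣β∣ (cong +_ ∣β∣≡1)) n≡2 H₁
    where
    β≡+∣β∣ : β a b ≡ + ∣ β a b ∣
    β≡+∣β∣ = 0≤b⇒β≡+∣β∣ a b 0≤b
    α≢∣β∣ : α a b ≢ ∣ β a b ∣
    α≢∣β∣ α≡∣β∣ = β≢α (trans β≡+∣β∣ (cong +_ (sym α≡∣β∣)))
    H₂′ : (+ n) ^ α a b Signed.∣ (+ α a b) ^ n - (+ ∣ β a b ∣) ^ n
    H₂′ = subst (λ z → (+ n) ^ α a b Signed.∣ (+ α a b) ^ n - z ^ n) β≡+∣β∣ (Signed.∣ᵤ⇒∣ H₂)

  forward₁ : (2 ℕD.∣ n → b ≥ 0ℤ) → (¬ (2 ℕD.∣ n) → β a b ≢ - (+ α a b)) →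
             ((+ n) ^ a ∣ (+ a) ^ n + b ^ n) × ((+ n) ^ α a b ∣ (+ α a b) ^ n + (β a b) ^ n) → Solutions₁ a b n
  forward₁ even⇒0≤b odd⇒β≢-α (H₁ , H₂) with 2 ℕD.∣? n
  ... | no 2∤n  = inj₁ (forward₁-odd 2∤n (odd⇒β≢-α 2∤n) H₁ H₂)
  ... | yes 2∣n = inj₂ (forward₁-even 2∣n (even⇒0≤b 2∣n) H₁ H₂)

  forward₂ : (2 ℕD.∣ n → b ≥ 0ℤ) → β a b ≢ + α a b →
             ((+ n) ^ a ∣ (+ a) ^ n - b ^ n) × ((+ n) ^ α a b ∣ (+ α a b) ^ n - (β a b) ^ n) → Solutions₂ a b n
  forward₂ even⇒0≤b β≢α (H₁ , H₂) with 2 ℕD.∣? n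
  ... | no 2∤n  = inj₂ (forward₂-odd 2∤n β≢α H₁ H₂)
  ... | yes 2∣n = inj₁ (forward₂-even 2∣n (even⇒0≤b 2∣n) β≢α H₁ H₂)

backward₁ : ∀ {a b n} → Solutions₁ a b n →
            ((+ n) ^ a ∣ (+ a) ^ n + b ^ n) × ((+ n) ^ α a b ∣ (+ α a b) ^ n + (β a b) ^ n)
backward₁ (inj₁ (refl , refl , refl))                   = ℕD.divides 1 refl , ℕD.divides 1 refl
backward₁ (inj₂ (0 , _ , refl , refl , refl))           = ℕD.divides 1 refl , ℕD.divides 1 refl
backward₁ (inj₂ (1 , _ , refl , refl , refl))           = ℕD.divides 2 refl , ℕD.divides 1 refl
backward₁ (inj₂ (2 , _ , refl , refl , refl))           = ℕD.divides 2 refl , ℕD.divides 1 refl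
backward₁ (inj₂ (suc (suc (suc _)) , ℕ.s≤s (ℕ.s≤s ()) , _))

backward₂ : ∀ {a b n} → Solutions₂ a b n →
            ((+ n) ^ a ∣ (+ a) ^ n - b ^ n) × ((+ n) ^ α a b ∣ (+ α a b) ^ n - (β a b) ^ n)
backward₂ (inj₁ (refl , refl , refl)) = ℕD.divides 1 refl , ℕD.divides 1 refl
backward₂ (inj₂ (refl , refl , refl)) = ℕD.divides 1 refl , ℕD.divides 1 refl

theorem1 : (a : ℕ) (b : ℤ) (n : ℕ) → 2 ≤ n → 1 ≤ a → ∣ b ∣ ≤ a → (2 ℕD.∣ n → b ≥ 0ℤ) →
    ((¬ (2 ℕD.∣ n) → β a b ≢ - (+ α a b)) →
      (((+ n) ^ a ∣ (+ a) ^ n + b ^ n) × ((+ n) ^ α a b ∣ (+ α a b) ^ n + (β a b) ^ n))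
      ⇔ ((a ≡ 2 × b ≡ + 1 × n ≡ 3)
         ⊎ ∃ λ c → c ≤ 2 × a ≡ 2 ℕ.^ c × b ≡ + (2 ℕ.^ c) × n ≡ 2))
    × (β a b ≢ + α a b →
      (((+ n) ^ a ∣ (+ a) ^ n - b ^ n) × ((+ n) ^ α a b ∣ (+ α a b) ^ n - (β a b) ^ n))
      ⇔ ((a ≡ 3 × b ≡ + 1 × n ≡ 2) ⊎ (a ≡ 2 × b ≡ - (+ 1) × n ≡ 3)))
theorem1 a b n 2≤n 1≤a ∣b∣≤a even⇒0≤b =
  (λ odd⇒β≢-α → mk⇔ (forward₁ a b n 2≤n 1≤a ∣b∣≤a even⇒0≤b odd⇒β≢-α) backward₁) ,
  (λ β≢α → mk⇔ (forward₂ a b n 2≤n 1≤a ∣b∣≤a even⇒0≤b β≢α) backward₂)
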